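{- Let $p\equiv 1\pmod 5$ be prime and let $\psi$ be a character of order $5$ of $\mathbb{F}_p^*$. If $a,b,c\in\mathbb{Z}$ satisfy $a+c\not\equiv0\pmod5$ and $b+c\not\equiv 0\pmod 5$, then $$\sum_{\chi}\chi(-1)\,J(\bar\chi\psi^a,\,\bar\chi\psi^b,\,\chi\psi^c)=-(p-1),$$ where the sum is over all multiplicative characters $\chi$ of $\mathbb{F}_p^*$.
   Context: Multiplicative characters of $\mathbb{F}_p^*$ (including the trivial one) are extended to $\mathbb{F}_p$ by setting $\chi(0):=0$; $\bar\chi$ denotes the inverse character. For characters $\chi_1,\dots,\chi_k$ the generalized Jacobi sum is $J(\chi_1,\dots,\chi_k):=\sum_{t_1+\dots+t_k=1,\ t_i\in\mathbb{F}_p}\chi_1(t_1)\cdots\chi_k(t_k)$. -}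

module Defs where

open import Level using (_⊔_)
open import Data.Nat using (ℕ; zero; suc; _∸_; NonZero; _<_) renaming (_+_ to _+ℕ_; _*_ to _*ℕ_)
open import Data.Nat.DivMod using (_mod_)
open import Data.Fin using (Fin; toℕ) renaming (zero to fzero; suc to fsuc)
open import Data.Integer using (ℤ; +_; -[1+_])
open import Data.Product using (∃; _×_)
open import Data.Sum using (_⊎_)
open import Relation.Nullary using (¬_)
open import Relation.Binary.PropositionalEquality using (_≡_)
open import Algebra.Bundles using (CommutativeRing)

-- Hypotheses on the coefficient ring R (playing the role of ℂ):
-- an integral domain of characteristic zero.
module _ {c ℓ} (R : CommutativeRing c ℓ) where
  open CommutativeRing R

  fromℕ : ℕ → Carrier
  fromℕ zero = 0#
  fromℕ (suc n) = 1# + fromℕ n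

  pw : Carrier → ℕ → Carrier
  pw x zero = 1#
  pw x (suc n) = x * pw x n

  IsIntegralDomain : Set (c ⊔ ℓ)
  IsIntegralDomain = (¬ (1# ≈ 0#)) × (∀ x y → x * y ≈ 0# → x ≈ 0# ⊎ y ≈ 0#)

  HasCharZero : Set ℓ
  HasCharZero = ∀ n → ¬ (fromℕ (suc n) ≈ 0#)

  IsPrimitiveRoot : ℕ → Carrier → Set ℓ
  IsPrimitiveRoot m ζ = pw ζ m ≈ 1# × (∀ k → 0 < k → k < m → ¬ (pw ζ k ≈ 1#))

  ∑ : (n : ℕ) → (Fin n → Carrier) → Carrier
  ∑ zero f = 0#
  ∑ (suc n) f = f fzero + ∑ n (λ i → f (fsuc i))

  module Fp (p : ℕ) {{_ : NonZero p}} where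

    F : Set
    F = Fin p

    [_] : ℕ → F
    [ n ] = n mod p

    0F 1F -1F : F
    0F = [ 0 ]
    1F = [ 1 ]
    -1F = [ p ∸ 1 ]

    _·_ : F → F → F
    x · y = [ toℕ x *ℕ toℕ y ]

    -- 1 - s - t  computed as (1 + (p - s) + (p - t)) mod p
    oneMinus : F → F → F
    oneMinus s t = [ suc ((p ∸ toℕ s) +ℕ (p ∸ toℕ t)) ]

    -- "functions" F → R; a multiplicative character of 𝔽_p^*, extended by χ(0) = 0
    Fn : Set c
    Fn = F → Carrier

    _≗R_ : Fn → Fn → Set ℓ
    f ≗R g = ∀ x → f x ≈ g x

    IsCharacter : Fn → Set ℓ
    IsCharacter χ = (χ 0F ≈ 0#) × (χ 1F ≈ 1#) × (∀ x y → χ (x · y) ≈ χ x * χ y)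

    triv : Fn
    triv x with toℕ x
    ... | zero = 0#
    ... | suc _ = 1#

    _⊗_ : Fn → Fn → Fn
    (f ⊗ g) x = f x * g x

    -- inverse character  χ̄(x) = χ(x)^(p-2) = χ(x)^(-1) on 𝔽_p^*, 0 at 0
    conj : Fn → Fn
    conj χ x = triv x * pw (χ x) (p ∸ 2)

    -- integer powers of a character in the character group, χ^0 = trivial character
    chPow : Fn → ℤ → Fn
    chPow χ (+ n) x = triv x * pw (χ x) n
    chPow χ -[1+ n ] x = triv x * pw (pw (χ x) (p ∸ 2)) (suc n)

    HasOrder : Fn → ℕ → Set ℓ
    HasOrder χ n = (chPow χ (+ n) ≗R triv)
                 × (∀ m → 0 < m → m < n → ¬ (chPow χ (+ m) ≗R triv))

    -- Generalized Jacobi sum of three characters: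
    -- J(χ₁,χ₂,χ₃) = Σ_{t₁+t₂+t₃=1} χ₁(t₁)χ₂(t₂)χ₃(t₃)
    J₃ : Fn → Fn → Fn → Carrier
    J₃ χ₁ χ₂ χ₃ = ∑ p (λ t₁ → ∑ p (λ t₂ → χ₁ t₁ * χ₂ t₂ * χ₃ (oneMinus t₁ t₂)))

    EnumeratesCharacters : (n : ℕ) → (Fin n → Fn) → Set (c ⊔ ℓ)
    EnumeratesCharacters n cs =
      (∀ i → IsCharacter (cs i))
      × (∀ i j → cs i ≗R cs j → i ≡ j)
      × (∀ χ → IsCharacter χ → ∃ λ i → χ ≗R cs i)

module Submission where

-- Expanding the Jacobi sums and exchanging the order of summation, the left-hand
-- side becomes Σ_{t₁,t₂} K(t₁,t₂) Σ_χ χ(y), where t₃ = 1 - t₁ - t₂,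
-- K = ψ^a(t₁)ψ^b(t₂)ψ^c(t₃) (zero unless t₁t₂t₃ ≠ 0) and y = -t₃/(t₁t₂).
-- By orthogonality Σ_χ χ(y) = (p-1)[y = 1], and y = 1 ⟺ (t₁-1)(t₂-1) = 0, so only
-- the lines t₁ = 1 and t₂ = 1 contribute.  There K is ψ^(b+c), resp. ψ^(a+c)
-- (because ψ(-1) = 1), whose sums over 𝔽_p vanish as 5 ∤ b+c, a+c; the point
-- (1,1), counted twice, has K = 1.  Hence the total is (p-1)(0 + 0 - 1).

open import Defs

open import Data.Nat as ℕ using (ℕ; zero; suc; _∸_; _<_; _≤_; z≤n; s≤s)
import Data.Nat.Properties as ℕP
open import Data.Fin as Fin using (Fin; toℕ; punchOut) renaming (zero to fzero; suc to fsuc)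
import Data.Fin.Properties as FinP
open import Data.Fin.Permutation using (Permutation; permutation)
open import Data.Product using (∃; _×_; _,_; proj₁; proj₂)
open import Data.Sum as Sum using (_⊎_; inj₁; inj₂; [_,_]′)
open import Data.Empty using (⊥; ⊥-elim)
open import Relation.Nullary using (¬_; ¬?; Dec; yes; no)
open import Relation.Binary.PropositionalEquality as ≡ using (_≡_; _≢_)
open import Algebra.Bundles using (CommutativeRing)
open import Data.Nat.Primality using (Prime)
open import Data.Nat.Divisibility using () renaming (_∣_ to _∣ℕ_)
open import Data.Integer as ℤ using (ℤ)
open import Data.Integer.Divisibility using () renaming (_∣_ to _∣ℤ_)

injective⇒surjective : ∀ {n} (σ : Fin n → Fin n) → (∀ i j → σ i ≡ σ j → i ≡ j) →
                       ∀ y → ∃ λ x → σ x ≡ y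
injective⇒surjective {zero} σ inj ()
injective⇒surjective {suc n} σ inj y with FinP.any? (λ x → σ x FinP.≟ y)
... | yes hit = hit
... | no miss = ⊥-elim (collision (FinP.pigeonhole (ℕP.n<1+n n) squeeze))
  where
  avoids : ∀ x → y ≢ σ x
  avoids x y≡σx = miss (x , ≡.sym y≡σx)
  -- σ misses y, so it factors through Fin n, which is too small
  squeeze : Fin (suc n) → Fin n
  squeeze x = punchOut (avoids x)
  collision : (∃ λ i → ∃ λ j → i Fin.< j × squeeze i ≡ squeeze j) → ⊥
  collision (i , j , i<j , e) with inj i j (FinP.punchOut-injective (avoids i) (avoids j) e)
  ... | ≡.refl = FinP.<-irrefl ≡.refl i<j

injective⇒permutation : ∀ {n} (σ : Fin n → Fin n) → (∀ i j → σ i ≡ σ j → i ≡ j) →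
                        Permutation n n
injective⇒permutation σ inj = permutation σ (λ y → proj₁ (onto y)) (λ y → proj₂ (onto y))
  (λ x → inj _ _ (proj₂ (onto (σ x))))
  where onto = injective⇒surjective σ inj

module RingFacts {c ℓ} (R : CommutativeRing c ℓ) where
  open CommutativeRing R
  open import Algebra.Properties.Semiring.Sum semiring
    using (sum; sum-cong-≋; sum-permute) renaming (∑-comm to sum-comm; ∑-distrib-+ to sum-distrib-+)
  open import Algebra.Properties.Semiring.Sum semiring using (*-distribˡ-sum)
  open import Algebra.Properties.CommutativeSemiring.Exp commutativeSemiring
    using (_^_; ^-congˡ; ^-homo-*; ^-assocʳ; ^-distrib-*)
  open import Algebra.Properties.Ring ring public using (x[y-z]≈xy-xz; [y-z]x≈yx-zx)
  open import Relation.Binary.Reasoning.Setoid setoid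
  open import Data.Nat.Divisibility using (_∣_; m%n≡0⇒n∣m)
  open import Algebra.Properties.CommutativeSemigroup *-commutativeSemigroup public
    using () renaming (interchange to *-interchange)

  ∑≡sum : ∀ n (f : Fin n → Carrier) → ∑ R n f ≡ sum f
  ∑≡sum zero f = ≡.refl
  ∑≡sum (suc n) f = ≡.cong (f fzero +_) (∑≡sum n (λ i → f (fsuc i)))

  ∑≈sum : ∀ {n} (f : Fin n → Carrier) → ∑ R n f ≈ sum f
  ∑≈sum {n} f = reflexive (∑≡sum n f)

  via-sum : ∀ {n k} (f : Fin n → Carrier) (g : Fin k → Carrier) →
            sum f ≈ sum g → ∑ R n f ≈ ∑ R k g
  via-sum f g e = trans (∑≈sum f) (trans e (sym (∑≈sum g)))

  ∑-cong : ∀ n {f g : Fin n → Carrier} → (∀ i → f i ≈ g i) → ∑ R n f ≈ ∑ R n g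
  ∑-cong n {f} {g} f≈g = via-sum f g (sum-cong-≋ f≈g)

  ∑-+ : ∀ n (f g : Fin n → Carrier) → ∑ R n (λ i → f i + g i) ≈ ∑ R n f + ∑ R n g
  ∑-+ n f g = trans (∑≈sum (λ i → f i + g i)) (trans (sum-distrib-+ f g) (sym (+-cong (∑≈sum f) (∑≈sum g))))

  ∑-*ˡ : ∀ n a (f : Fin n → Carrier) → ∑ R n (λ i → a * f i) ≈ a * ∑ R n f
  ∑-*ˡ n a f = trans (∑≈sum (λ i → a * f i)) (trans (sym (*-distribˡ-sum a f)) (*-congˡ (sym (∑≈sum f))))

  ∑-*ʳ : ∀ n a (f : Fin n → Carrier) → ∑ R n (λ i → f i * a) ≈ ∑ R n f * a
  ∑-*ʳ n a f = trans (∑-cong n (λ i → *-comm (f i) a)) (trans (∑-*ˡ n a f) (*-comm a _))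

  ∑-comm : ∀ n k (f : Fin n → Fin k → Carrier) →
           ∑ R n (λ i → ∑ R k (f i)) ≈ ∑ R k (λ j → ∑ R n (λ i → f i j))
  ∑-comm n k f = begin
    ∑ R n (λ i → ∑ R k (f i))       ≈⟨ ∑-cong n (λ i → ∑≈sum (f i)) ⟩
    ∑ R n (λ i → sum (f i))         ≈⟨ via-sum (λ i → sum (f i)) (λ j → sum (λ i → f i j)) (sum-comm f) ⟩
    ∑ R k (λ j → sum (λ i → f i j)) ≈⟨ ∑-cong k (λ j → sym (∑≈sum (λ i → f i j))) ⟩
    ∑ R k (λ j → ∑ R n (λ i → f i j)) ∎

  ∑-reindex : ∀ n (σ : Fin n → Fin n) → (∀ i j → σ i ≡ σ j → i ≡ j) → ∀ f →
              ∑ R n (λ i → f (σ i)) ≈ ∑ R n f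
  ∑-reindex n σ inj f = via-sum (λ i → f (σ i)) f (sym (sum-permute f (injective⇒permutation σ inj)))

  ∑-zero : ∀ n {f : Fin n → Carrier} → (∀ i → f i ≈ 0#) → ∑ R n f ≈ 0#
  ∑-zero zero f≈0 = refl
  ∑-zero (suc n) f≈0 = trans (+-cong (f≈0 fzero) (∑-zero n (λ i → f≈0 (fsuc i)))) (+-identityˡ 0#)

  ∑-single : ∀ n (i₀ : Fin n) (f : Fin n → Carrier) → (∀ i → i ≢ i₀ → f i ≈ 0#) → ∑ R n f ≈ f i₀
  ∑-single (suc n) fzero f f≈0 =
    trans (+-congˡ (∑-zero n (λ i → f≈0 (fsuc i) (λ ())))) (+-identityʳ _)
  ∑-single (suc n) (fsuc i₀) f f≈0 = trans (+-congʳ (f≈0 fzero (λ ()))) (trans (+-identityˡ _)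
    (∑-single n i₀ (λ i → f (fsuc i)) (λ i i≢i₀ → f≈0 (fsuc i) (λ e → i≢i₀ (FinP.suc-injective e)))))

  ∑-ones : ∀ n → ∑ R n (λ _ → 1#) ≈ fromℕ R n
  ∑-ones zero = refl
  ∑-ones (suc n) = +-congˡ (∑-ones n)

  pw≡^ : ∀ x n → pw R x n ≡ x ^ n
  pw≡^ x zero = ≡.refl
  pw≡^ x (suc n) = ≡.cong (x *_) (pw≡^ x n)

  pw-cong : ∀ {x y} n → x ≈ y → pw R x n ≈ pw R y n
  pw-cong {x} {y} n x≈y rewrite pw≡^ x n | pw≡^ y n = ^-congˡ n x≈y

  pw-+ : ∀ x a b → pw R x (a ℕ.+ b) ≈ pw R x a * pw R x b
  pw-+ x a b rewrite pw≡^ x (a ℕ.+ b) | pw≡^ x a | pw≡^ x b = ^-homo-* x a b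

  pw-* : ∀ x a b → pw R x (a ℕ.* b) ≈ pw R (pw R x a) b
  pw-* x a b rewrite pw≡^ x (a ℕ.* b) | pw≡^ x a | pw≡^ (x ^ a) b = sym (^-assocʳ x a b)

  pw-distrib : ∀ x y n → pw R (x * y) n ≈ pw R x n * pw R y n
  pw-distrib x y n rewrite pw≡^ (x * y) n | pw≡^ x n | pw≡^ y n = ^-distrib-* x y n

  pw-1 : ∀ n → pw R 1# n ≈ 1#
  pw-1 zero = refl
  pw-1 (suc n) = trans (*-identityˡ _) (pw-1 n)

  order-divides : ∀ u d .{{_ : ℕ.NonZero d}} → pw R u d ≈ 1# →
                  (∀ r → 0 < r → r < d → ¬ (pw R u r ≈ 1#)) → ∀ j → pw R u j ≈ 1# → d ∣ j
  order-divides u d u^d≈1 u^r≉1 j u^j≈1 = m%n≡0⇒n∣m j d (remainder≡0 (j % d) (m%n<n j d) (begin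
    pw R u (j % d)                          ≈⟨ sym (*-identityʳ _) ⟩
    pw R u (j % d) * 1#                     ≈⟨ *-congˡ (sym u^[j/d]d≈1) ⟩
    pw R u (j % d) * pw R u (j / d ℕ.* d)   ≈⟨ sym (pw-+ u (j % d) (j / d ℕ.* d)) ⟩
    pw R u (j % d ℕ.+ j / d ℕ.* d)          ≡⟨ ≡.cong (pw R u) (≡.sym (m≡m%n+[m/n]*n j d)) ⟩
    pw R u j                                ≈⟨ u^j≈1 ⟩
    1#                                      ∎))
    where
    open import Data.Nat using (_%_; _/_)
    open import Data.Nat.DivMod using (m≡m%n+[m/n]*n; m%n<n)
    u^[j/d]d≈1 : pw R u (j / d ℕ.* d) ≈ 1#
    u^[j/d]d≈1 = begin
      pw R u (j / d ℕ.* d)    ≡⟨ ≡.cong (pw R u) (ℕP.*-comm (j / d) d) ⟩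
      pw R u (d ℕ.* (j / d))  ≈⟨ pw-* u d (j / d) ⟩
      pw R (pw R u d) (j / d) ≈⟨ pw-cong (j / d) u^d≈1 ⟩
      pw R 1# (j / d)         ≈⟨ pw-1 (j / d) ⟩
      1#                      ∎
    remainder≡0 : ∀ r → r < d → pw R u r ≈ 1# → r ≡ 0
    remainder≡0 zero _ _ = ≡.refl
    remainder≡0 (suc r) r<d u^r≈1 = ⊥-elim (u^r≉1 (suc r) (s≤s z≤n) r<d u^r≈1)

  difference≈0⇒≈ : ∀ {x y} → x - y ≈ 0# → x ≈ y
  difference≈0⇒≈ = x∙y⁻¹≈ε⇒x≈y _ _
    where open import Algebra.Properties.Group +-group using (x∙y⁻¹≈ε⇒x≈y)

  ≈⇒difference≈0 : ∀ {x y} → x ≈ y → x - y ≈ 0#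
  ≈⇒difference≈0 = x≈y⇒x∙y⁻¹≈ε
    where open import Algebra.Properties.Group +-group using (x≈y⇒x∙y⁻¹≈ε)

  ∑-modify : ∀ n (i₀ : Fin n) (f h : Fin n → Carrier) → (∀ i → i ≢ i₀ → f i ≈ h i) →
             ∑ R n f ≈ ∑ R n h + (f i₀ - h i₀)
  ∑-modify n i₀ f h f≈h = begin
    ∑ R n f                                 ≈⟨ ∑-cong n (λ i → sym (h+[f-h]≈f (h i) (f i))) ⟩
    ∑ R n (λ i → h i + (f i - h i))         ≈⟨ ∑-+ n h (λ i → f i - h i) ⟩
    ∑ R n h + ∑ R n (λ i → f i - h i)       ≈⟨ +-congˡ (∑-single n i₀ (λ i → f i - h i)
                                                 (λ i i≢i₀ → ≈⇒difference≈0 (f≈h i i≢i₀))) ⟩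
    ∑ R n h + (f i₀ - h i₀)                 ∎
    where
    h+[f-h]≈f : ∀ u v → u + (v - u) ≈ v
    h+[f-h]≈f u v = trans (+-congˡ (+-comm v (- u))) (trans (sym (+-assoc u (- u) v))
      (trans (+-congʳ (-‿inverseʳ u)) (+-identityˡ v)))

  -- a double sum supported on the cross {i₀} × _ ∪ _ × {j₀} (inclusion–exclusion)
  ∑-cross : ∀ n l (i₀ : Fin n) (j₀ : Fin l) (f : Fin n → Fin l → Carrier) →
            (∀ i j → i ≢ i₀ → j ≢ j₀ → f i j ≈ 0#) →
            ∑ R n (λ i → ∑ R l (f i)) ≈ ∑ R n (λ i → f i j₀) + (∑ R l (f i₀) - f i₀ j₀)
  ∑-cross n l i₀ j₀ f off-cross = ∑-modify n i₀ (λ i → ∑ R l (f i)) (λ i → f i j₀)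
    (λ i i≢i₀ → ∑-single l j₀ (f i) (λ j j≢j₀ → off-cross i j i≢i₀ j≢j₀))

  private module Solver where
    open import Algebra.Solver.Ring.NaturalCoefficients.Default commutativeSemiring public

  -- the expansions of x·G + c and of a Horner step around r, with u = x - r
  shift-linear : ∀ u r G c → (u + r) * G + c ≈ u * G + (r * G + c)
  shift-linear = solve 4 (λ u r G c → (u :+ r) :* G :+ c := u :* G :+ (r :* G :+ c)) refl
    where open Solver

  shift-horner : ∀ u r H G c →
                 (u + r) * ((u * H) + G) + c ≈ u * ((u + r) * H + G) + (r * G + c)
  shift-horner = solve 5 (λ u r H G c → (u :+ r) :* (u :* H :+ G) :+ c
                                      := u :* ((u :+ r) :* H :+ G) :+ (r :* G :+ c)) refl
    where open Solver

  expand : ∀ a b c → (a + c) * (b + c) ≈ a * b + (c * c + c * a + c * b)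
  expand = solve 3 (λ a b c → (a :+ c) :* (b :+ c) := a :* b :+ (c :* c :+ c :* a :+ c :* b)) refl
    where open Solver

  -- brings each t_i next to its inverse t_i^k in y(t₁,t₂)·t₁t₂
  pair-factors : ∀ n u v s t w → n * u * v * w * (s * t) ≈ n * (u * s) * (v * t) * w
  pair-factors = solve 6 (λ n u v s t w → n :* u :* v :* w :* (s :* t) := n :* (u :* s) :* (v :* t) :* w) refl
    where open Solver

module DomainFacts {c ℓ} (R : CommutativeRing c ℓ) (domain : IsIntegralDomain R) where
  open CommutativeRing R
  open RingFacts R using (difference≈0⇒≈; ≈⇒difference≈0; [y-z]x≈yx-zx)

  1≉0 : ¬ (1# ≈ 0#)
  1≉0 = proj₁ domain

  *-nonzero : ∀ {x y} → ¬ (x ≈ 0#) → ¬ (y ≈ 0#) → ¬ (x * y ≈ 0#)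
  *-nonzero x≉0 y≉0 xy≈0 with proj₂ domain _ _ xy≈0
  ... | inj₁ x≈0 = x≉0 x≈0
  ... | inj₂ y≈0 = y≉0 y≈0

  *-cancelʳ : ∀ {a b c} → ¬ (c ≈ 0#) → a * c ≈ b * c → a ≈ b
  *-cancelʳ {a} {b} {c} c≉0 ac≈bc
    with proj₂ domain (a - b) c (trans ([y-z]x≈yx-zx c a b) (≈⇒difference≈0 ac≈bc))
  ... | inj₁ a-b≈0 = difference≈0⇒≈ a-b≈0
  ... | inj₂ c≈0 = ⊥-elim (c≉0 c≈0)

  fixed⇒0 : ∀ {a b} → ¬ (a ≈ 1#) → a * b ≈ b → b ≈ 0#
  fixed⇒0 {a} {b} a≉1 ab≈b with proj₂ domain (a - 1#) b
    (trans ([y-z]x≈yx-zx b a 1#) (≈⇒difference≈0 (trans ab≈b (sym (*-identityˡ b)))))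
  ... | inj₁ a-1≈0 = ⊥-elim (a≉1 (difference≈0⇒≈ a-1≈0))
  ... | inj₂ b≈0 = b≈0

-- ℤ/(n+1)ℤ as a commutative ring on Fin (suc n); the operations are the ones of
-- Defs.Fp (reduction 'mod' of the natural-number operations).
module Residues (n : ℕ) where
  open import Data.Nat using (_+_; _*_; _%_)
  open import Data.Nat.DivMod using (_mod_; m<n⇒m%n≡m; %-distribˡ-+; %-distribˡ-*; n%n≡0)
  open import Algebra.Structures using (IsCommutativeRing)

  p : ℕ
  p = suc n

  F : Set
  F = Fin p

  [_] : ℕ → F
  [ a ] = a mod p

  infixl 6 _⊕_
  infixl 7 _·_
  infix 8 ⊖_
  _⊕_ _·_ : F → F → F
  x ⊕ y = [ toℕ x + toℕ y ]
  x · y = [ toℕ x * toℕ y ]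

  ⊖_ : F → F
  ⊖ x = [ p ∸ toℕ x ]

  0F 1F : F
  0F = [ 0 ]
  1F = [ 1 ]

  toℕ[] : ∀ a → toℕ [ a ] ≡ a % p
  toℕ[] a = FinP.toℕ-fromℕ< _

  []-cong% : ∀ {a b} → a % p ≡ b % p → [ a ] ≡ [ b ]
  []-cong% {a} {b} e = FinP.toℕ-injective (≡.trans (toℕ[] a) (≡.trans e (≡.sym (toℕ[] b))))

  []-toℕ : ∀ x → [ toℕ x ] ≡ x
  []-toℕ x = FinP.toℕ-injective (≡.trans (toℕ[] (toℕ x)) (m<n⇒m%n≡m (FinP.toℕ<n x)))

  []-+ : ∀ a b → [ a + b ] ≡ [ a ] ⊕ [ b ]
  []-+ a b = []-cong% {a + b} {toℕ [ a ] + toℕ [ b ]} (≡.trans (%-distribˡ-+ a b p)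
    (≡.sym (≡.cong₂ (λ u v → (u + v) % p) (toℕ[] a) (toℕ[] b))))

  []-* : ∀ a b → [ a * b ] ≡ [ a ] · [ b ]
  []-* a b = []-cong% {a * b} {toℕ [ a ] * toℕ [ b ]} (≡.trans (%-distribˡ-* a b p)
    (≡.sym (≡.cong₂ (λ u v → (u * v) % p) (toℕ[] a) (toℕ[] b))))

  lift-identity : ∀ {f g : F → F → F → F} (fℕ gℕ : ℕ → ℕ → ℕ → ℕ) →
    (∀ a b c → f [ a ] [ b ] [ c ] ≡ [ fℕ a b c ]) →
    (∀ a b c → g [ a ] [ b ] [ c ] ≡ [ gℕ a b c ]) →
    (∀ a b c → fℕ a b c ≡ gℕ a b c) → ∀ x y z → f x y z ≡ g x y z
  lift-identity {f} {g} fℕ gℕ f-hom g-hom e x y z = begin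
    f x y z                          ≡⟨ ≡.sym (≡.cong₂ (λ u v → f u v z) ([]-toℕ x) ([]-toℕ y)) ⟩
    f [ x′ ] [ y′ ] z                ≡⟨ ≡.cong (f _ _) (≡.sym ([]-toℕ z)) ⟩
    f [ x′ ] [ y′ ] [ z′ ]           ≡⟨ f-hom x′ y′ z′ ⟩
    [ fℕ x′ y′ z′ ]                  ≡⟨ ≡.cong [_] (e x′ y′ z′) ⟩
    [ gℕ x′ y′ z′ ]                  ≡⟨ ≡.sym (g-hom x′ y′ z′) ⟩
    g [ x′ ] [ y′ ] [ z′ ]           ≡⟨ ≡.cong₂ (λ u v → g u v [ z′ ]) ([]-toℕ x) ([]-toℕ y) ⟩
    g x y [ z′ ]                     ≡⟨ ≡.cong (g _ _) ([]-toℕ z) ⟩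
    g x y z                          ∎
    where open ≡.≡-Reasoning
          x′ = toℕ x; y′ = toℕ y; z′ = toℕ z

  ⊕-comm : ∀ x y → x ⊕ y ≡ y ⊕ x
  ⊕-comm x y = ≡.cong [_] (ℕP.+-comm (toℕ x) (toℕ y))

  ·-comm : ∀ x y → x · y ≡ y · x
  ·-comm x y = ≡.cong [_] (ℕP.*-comm (toℕ x) (toℕ y))

  ⊕-assoc : ∀ x y z → (x ⊕ y) ⊕ z ≡ x ⊕ (y ⊕ z)
  ⊕-assoc = lift-identity (λ a b c → (a + b) + c) (λ a b c → a + (b + c))
    (λ a b c → ≡.trans (≡.cong (_⊕ [ c ]) (≡.sym ([]-+ a b))) (≡.sym ([]-+ (a + b) c)))
    (λ a b c → ≡.trans (≡.cong ([ a ] ⊕_) (≡.sym ([]-+ b c))) (≡.sym ([]-+ a (b + c))))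
    ℕP.+-assoc

  ·-assoc : ∀ x y z → (x · y) · z ≡ x · (y · z)
  ·-assoc = lift-identity (λ a b c → (a * b) * c) (λ a b c → a * (b * c))
    (λ a b c → ≡.trans (≡.cong (_· [ c ]) (≡.sym ([]-* a b))) (≡.sym ([]-* (a * b) c)))
    (λ a b c → ≡.trans (≡.cong ([ a ] ·_) (≡.sym ([]-* b c))) (≡.sym ([]-* a (b * c))))
    ℕP.*-assoc

  ·-distribˡ-⊕ : ∀ x y z → x · (y ⊕ z) ≡ (x · y) ⊕ (x · z)
  ·-distribˡ-⊕ = lift-identity (λ a b c → a * (b + c)) (λ a b c → a * b + a * c)
    (λ a b c → ≡.trans (≡.cong ([ a ] ·_) (≡.sym ([]-+ b c))) (≡.sym ([]-* a (b + c))))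
    (λ a b c → ≡.trans (≡.cong₂ _⊕_ (≡.sym ([]-* a b)) (≡.sym ([]-* a c))) (≡.sym ([]-+ (a * b) (a * c))))
    ℕP.*-distribˡ-+

  ⊕-identityˡ : ∀ x → 0F ⊕ x ≡ x
  ⊕-identityˡ x = []-toℕ x

  ·-identityˡ : ∀ x → 1F · x ≡ x
  ·-identityˡ x = begin
    1F · x             ≡⟨ ≡.cong (1F ·_) (≡.sym ([]-toℕ x)) ⟩
    [ 1 ] · [ toℕ x ]  ≡⟨ ≡.sym ([]-* 1 (toℕ x)) ⟩
    [ 1 * toℕ x ]      ≡⟨ ≡.cong [_] (ℕP.*-identityˡ (toℕ x)) ⟩
    [ toℕ x ]          ≡⟨ []-toℕ x ⟩
    x                  ∎
    where open ≡.≡-Reasoning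

  ⊖-inverseˡ : ∀ x → (⊖ x) ⊕ x ≡ 0F
  ⊖-inverseˡ x = begin
    [ p ∸ toℕ x ] ⊕ x          ≡⟨ ≡.cong ([ p ∸ toℕ x ] ⊕_) (≡.sym ([]-toℕ x)) ⟩
    [ p ∸ toℕ x ] ⊕ [ toℕ x ]  ≡⟨ ≡.sym ([]-+ (p ∸ toℕ x) (toℕ x)) ⟩
    [ (p ∸ toℕ x) + toℕ x ]    ≡⟨ ≡.cong [_] (ℕP.m∸n+n≡m (ℕP.<⇒≤ (FinP.toℕ<n x))) ⟩
    [ p ]                      ≡⟨ []-cong% {p} {0} (n%n≡0 p) ⟩
    0F                         ∎
    where open ≡.≡-Reasoning

  isCommutativeRing : IsCommutativeRing _≡_ _⊕_ _·_ ⊖_ 0F 1F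
  isCommutativeRing = record
    { isRing = record
      { +-isAbelianGroup = record
        { isGroup = record
          { isMonoid = record
            { isSemigroup = record
              { isMagma = record { isEquivalence = ≡.isEquivalence ; ∙-cong = ≡.cong₂ _⊕_ }
              ; assoc = ⊕-assoc }
            ; identity = ⊕-identityˡ , (λ x → ≡.trans (⊕-comm x 0F) (⊕-identityˡ x)) }
          ; inverse = ⊖-inverseˡ , (λ x → ≡.trans (⊕-comm x (⊖ x)) (⊖-inverseˡ x))
          ; ⁻¹-cong = ≡.cong ⊖_ }
        ; comm = ⊕-comm }
      ; *-cong = ≡.cong₂ _·_
      ; *-assoc = ·-assoc
      ; *-identity = ·-identityˡ , (λ x → ≡.trans (·-comm x 1F) (·-identityˡ x))
      ; distrib = ·-distribˡ-⊕ , (λ x y z → ≡.trans (·-comm (y ⊕ z) x)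
                    (≡.trans (·-distribˡ-⊕ x y z) (≡.cong₂ _⊕_ (·-comm x y) (·-comm x z)))) }
    ; *-comm = ·-comm }

  ring : CommutativeRing _ _
  ring = record { isCommutativeRing = isCommutativeRing }

module NatFacts where
  open import Data.Nat using (_+_; _*_; _^_; _%_; _/_; nonTrivial⇒n>1; nonTrivial⇒nonZero)
  open import Data.Nat.Divisibility
    using (_∣_; _∣?_; divides; ∣-refl; ∣-trans; ∣⇒≤; *-cancelʳ-∣; *-monoˡ-∣)
  open import Data.Nat.Coprimality using (Coprime; coprime-divisor; 1-coprimeTo)
  open import Data.Nat.Primality using (prime⇒irreducible; prime⇒nonTrivial)
  open import Data.Nat.Primality.Factorisation using (factorise)
  open import Data.Nat.Induction using (<-rec)
  open import Data.List using ([]; _∷_)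
  open import Data.Nat.ListAction using (product)
  open import Data.List.Relation.Unary.All using (_∷_)
  open import Data.Nat.Solver using (module +-*-Solver)
  open +-*-Solver

  prime>1 : ∀ {q} → Prime q → 1 < q
  prime>1 {q} q-prime = nonTrivial⇒n>1 q {{prime⇒nonTrivial q-prime}}

  prime-factor : ∀ d → 1 < d → ∃ λ q → Prime q × q ∣ d
  prime-factor (suc zero) (s≤s ())
  prime-factor d@(suc (suc _)) _ with factorise d
  ... | record { factors = [] ; isFactorisation = () }
  ... | record { factors = q ∷ rest ; isFactorisation = d≡q*rest ; factorsPrime = q-prime ∷ _ } =
    q , q-prime , divides (product rest) (≡.trans d≡q*rest (ℕP.*-comm q (product rest)))

  divisor-of-prime-power : ∀ {q} e d → Prime q → d ∣ q ^ suc e → d ≡ q ^ suc e ⊎ d ∣ q ^ e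
  divisor-of-prime-power {q} zero d q-prime d∣q
    with prime⇒irreducible q-prime (≡.subst (d ∣_) (ℕP.*-identityʳ q) d∣q)
  ... | inj₁ d≡1 = inj₂ (≡.subst (_∣ 1) (≡.sym d≡1) ∣-refl)
  ... | inj₂ d≡q = inj₁ (≡.trans d≡q (≡.sym (ℕP.*-identityʳ q)))
  divisor-of-prime-power {q} (suc e) d q-prime d∣q^e+2 with q ∣? d
  ... | yes (divides c ≡.refl) with divisor-of-prime-power e c q-prime c∣q^e+1
    where
    instance _ = nonTrivial⇒nonZero q {{prime⇒nonTrivial q-prime}}
    c∣q^e+1 : c ∣ q ^ suc e
    c∣q^e+1 = *-cancelʳ-∣ q (≡.subst (c * q ∣_) (ℕP.*-comm q (q ^ suc e)) d∣q^e+2)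
  ...   | inj₁ c≡q^e+1 = inj₁ (≡.trans (≡.cong (_* q) c≡q^e+1) (ℕP.*-comm (q ^ suc e) q))
  ...   | inj₂ c∣q^e = inj₂ (≡.subst (c * q ∣_) (ℕP.*-comm (q ^ e) q) (*-monoˡ-∣ q c∣q^e))
  divisor-of-prime-power {q} (suc e) d q-prime d∣q^e+2 | no q∤d =
    inj₂ (coprime-divisor (λ {i} → coprime i) d∣q^e+2)
    where
    coprime : ∀ i → i ∣ d × i ∣ q → i ≡ 1
    coprime i (i∣d , i∣q) with prime⇒irreducible q-prime i∣q
    ... | inj₁ i≡1 = i≡1
    ... | inj₂ ≡.refl = ⊥-elim (q∤d i∣d)

  prime-coprime : ∀ {q d} → Prime q → ¬ q ∣ d → Coprime q d
  prime-coprime q-prime q∤d {i} (i∣q , i∣d) with prime⇒irreducible q-prime i∣q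
  ... | inj₁ i≡1 = i≡1
  ... | inj₂ ≡.refl = ⊥-elim (q∤d i∣d)

  coprime-* : ∀ {a b c} → Coprime a c → Coprime b c → Coprime (a * b) c
  coprime-* {a} coprime-ac coprime-bc {i} (i∣ab , i∣c) = coprime-bc (coprime-divisor coprime-ia i∣ab , i∣c)
    where
    coprime-ia : Coprime i a
    coprime-ia (j∣i , j∣a) = coprime-ac (j∣a , ∣-trans j∣i i∣c)

  coprime-^ : ∀ {q d} → Coprime q d → ∀ e → Coprime (q ^ e) d
  coprime-^ coprime zero = 1-coprimeTo _
  coprime-^ coprime (suc e) = coprime-* coprime (coprime-^ coprime e)

  split-power : ∀ q → 1 < q → ∀ d → 0 < d → ∃ λ e → ∃ λ d′ → d ≡ q ^ e * d′ × ¬ q ∣ d′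
  split-power q 1<q = <-rec _ split
    where
    split : ∀ d → (∀ {c} → c < d → 0 < c → ∃ λ e → ∃ λ d′ → c ≡ q ^ e * d′ × ¬ q ∣ d′) →
            0 < d → ∃ λ e → ∃ λ d′ → d ≡ q ^ e * d′ × ¬ q ∣ d′
    split d rec 0<d with q ∣? d
    ... | no q∤d = 0 , d , ≡.sym (ℕP.+-identityʳ d) , q∤d
    ... | yes (divides zero ≡.refl) = ⊥-elim (ℕP.<-irrefl ≡.refl 0<d)
    ... | yes (divides c@(suc _) ≡.refl) with rec (ℕP.m<m*n c q 1<q) (s≤s z≤n)
    ...   | e , d′ , c≡ , q∤d′ = suc e , d′ , ≡.trans (≡.cong (_* q) c≡)
      (solve 3 (λ a b c → (a :* b) :* c := (c :* a) :* b) ≡.refl (q ^ e) d′ q) , q∤d′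

  close-congruent⇒≡ : ∀ {a b n} → a ≤ b → b < n → n ∣ b ∸ a → b ≡ a
  close-congruent⇒≡ {a} {b} a≤b b<n n∣b-a with b ∸ a in b-a≡
  ... | zero = ℕP.≤-antisym (ℕP.m∸n≡0⇒m≤n b-a≡) a≤b
  ... | suc r = ⊥-elim (ℕP.<-irrefl ≡.refl (ℕP.<-≤-trans b<n (ℕP.≤-trans (∣⇒≤ n∣b-a)
                  (ℕP.≤-trans (ℕP.≤-reflexive (≡.sym b-a≡)) (ℕP.m∸n≤m b a)))))

  ≡1-mod-5⇒5∣pred : ∀ q → q % 5 ≡ 1 → 5 ∣ q ∸ 1
  ≡1-mod-5⇒5∣pred q q%5≡1 = divides (q / 5)
    (≡.cong (_∸ 1) (≡.trans (m≡m%n+[m/n]*n q 5) (≡.cong (_+ q / 5 * 5) q%5≡1)))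
    where open import Data.Nat.DivMod using (m≡m%n+[m/n]*n)

  least-below : (P : ℕ → Set) → (∀ j → Dec (P j)) → ∀ bound →
    (∃ λ d → d < bound × P d × (∀ j → j < d → ¬ P j)) ⊎ (∀ j → j < bound → ¬ P j)
  least-below P P? zero = inj₂ (λ j ())
  least-below P P? (suc n) with least-below P P? n
  ... | inj₁ (d , d<n , Pd , minimal) = inj₁ (d , ℕP.m<n⇒m<1+n d<n , Pd , minimal)
  ... | inj₂ none with P? n
  ...   | yes Pn = inj₁ (n , ℕP.n<1+n n , Pn , none)
  ...   | no ¬Pn = inj₂ below
    where
    below : ∀ j → j < suc n → ¬ P j
    below j j<1+n with ℕP.m≤n⇒m<n∨m≡n (ℕP.≤-pred j<1+n)
    ... | inj₁ j<n = none j j<n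
    ... | inj₂ ≡.refl = ¬Pn

-- The prime field 𝔽_p, p = k + 2: no zero divisors, Fermat's little theorem.
module PrimeField (k : ℕ) (p-prime : Prime (suc (suc k))) where
  open Residues (suc k) public
  open import Data.Nat using (_*_)
  open import Data.Nat.Divisibility using (_∣_; m%n≡0⇒n∣m; >⇒∤)
  open import Data.Nat.Primality using (euclidsLemma)
  open import Algebra.Properties.CommutativeMonoid.Sum (CommutativeRing.*-commutativeMonoid ring)
    using (sum-permute; sum-cong-≗) renaming (sum to product)
  open CommutativeRing ring using (_-_; zeroˡ; zeroʳ; *-identityʳ; +-identityʳ)
  private module FR = RingFacts ring

  -- the order p - 1 of 𝔽_p^*
  m : ℕ
  m = suc k

  infixr 8 _^_
  _^_ : F → ℕ → F
  x ^ e = pw ring x e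

  ^-+ : ∀ x a b → x ^ (a ℕ.+ b) ≡ x ^ a · x ^ b
  ^-+ = FR.pw-+

  1≢0 : 1F ≢ 0F
  1≢0 ()

  x·0≡0 : ∀ x → x · 0F ≡ 0F
  x·0≡0 = zeroʳ

  multiple-of-p⇒0 : ∀ (x : F) → p ∣ toℕ x → x ≡ 0F
  multiple-of-p⇒0 fzero p∣x = ≡.refl
  multiple-of-p⇒0 (fsuc i) p∣x = ⊥-elim (>⇒∤ (FinP.toℕ<n (fsuc i)) p∣x)

  abstract
    -- Euclid's lemma: 𝔽_p has no zero divisors (kept abstract: only its statement is used)
    no-zero-divisors : ∀ x y → x · y ≡ 0F → x ≡ 0F ⊎ y ≡ 0F
    no-zero-divisors x y xy≡0
      with euclidsLemma (toℕ x) (toℕ y) p-prime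
             (m%n≡0⇒n∣m _ p (≡.trans (≡.sym (toℕ[] (toℕ x * toℕ y))) (≡.cong toℕ xy≡0)))
    ... | inj₁ p∣x = inj₁ (multiple-of-p⇒0 x p∣x)
    ... | inj₂ p∣y = inj₂ (multiple-of-p⇒0 y p∣y)

  ·-nonzero : ∀ {x y} → x ≢ 0F → y ≢ 0F → x · y ≢ 0F
  ·-nonzero x≢0 y≢0 xy≡0 with no-zero-divisors _ _ xy≡0
  ... | inj₁ x≡0 = x≢0 x≡0
  ... | inj₂ y≡0 = y≢0 y≡0

  ^-nonzero : ∀ x e → x ≢ 0F → x ^ e ≢ 0F
  ^-nonzero x zero x≢0 = 1≢0
  ^-nonzero x (suc e) x≢0 = ·-nonzero x≢0 (^-nonzero x e x≢0)

  ·-cancelˡ : ∀ a {x y} → a ≢ 0F → a · x ≡ a · y → x ≡ y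
  ·-cancelˡ a {x} {y} a≢0 ax≡ay = [ (λ a≡0 → ⊥-elim (a≢0 a≡0)) , FR.difference≈0⇒≈ ]′
    (no-zero-divisors a (x - y) (≡.trans (FR.x[y-z]≈xy-xz a x y) (FR.≈⇒difference≈0 ax≡ay)))

  -- 𝔽_p^* is enumerated by Fin m via fsuc
  unsuc : (x : F) → x ≢ 0F → Fin m
  unsuc fzero x≢0 = ⊥-elim (x≢0 ≡.refl)
  unsuc (fsuc i) x≢0 = i

  fsuc-unsuc : ∀ x x≢0 → fsuc (unsuc x x≢0) ≡ x
  fsuc-unsuc fzero x≢0 = ⊥-elim (x≢0 ≡.refl)
  fsuc-unsuc (fsuc i) x≢0 = ≡.refl

  product-scale : ∀ n a (f : Fin n → F) → product (λ i → a · f i) ≡ a ^ n · product f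
  product-scale zero a f = ≡.sym (*-identityʳ 1F)
  product-scale (suc n) a f = ≡.trans (≡.cong (a · f fzero ·_) (product-scale n a (λ i → f (fsuc i))))
    (FR.*-interchange a (f fzero) (a ^ n) (product (λ i → f (fsuc i))))

  product-nonzero : ∀ n (f : Fin n → F) → (∀ i → f i ≢ 0F) → product f ≢ 0F
  product-nonzero zero f f≢0 = 1≢0
  product-nonzero (suc n) f f≢0 =
    ·-nonzero (f≢0 fzero) (product-nonzero n (λ i → f (fsuc i)) (λ i → f≢0 (fsuc i)))

  -- Fermat: multiplication by a ≠ 0 permutes 𝔽_p^*, so a^m Π x = Π x
  fermat : ∀ a → a ≢ 0F → a ^ m ≡ 1F
  fermat a a≢0 = ·-cancelˡ P P≢0 (≡.trans (·-comm P (a ^ m)) (≡.sym P≡a^mP′))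
    where
    elements : Fin m → F
    elements = fsuc
    P = product elements
    P≢0 : P ≢ 0F
    P≢0 = product-nonzero m elements (λ i ())
    a·x≢0 : ∀ i → a · fsuc i ≢ 0F
    a·x≢0 i = ·-nonzero a≢0 (λ ())
    σ : Fin m → Fin m
    σ i = unsuc (a · fsuc i) (a·x≢0 i)
    σ-injective : ∀ i j → σ i ≡ σ j → i ≡ j
    σ-injective i j σi≡σj = FinP.suc-injective (·-cancelˡ a a≢0
      (≡.trans (≡.sym (fsuc-unsuc _ _)) (≡.trans (≡.cong fsuc σi≡σj) (fsuc-unsuc _ _))))
    P≡a^mP′ : P · 1F ≡ a ^ m · P
    P≡a^mP′ = begin
      P · 1F                            ≡⟨ *-identityʳ P ⟩
      P                                 ≡⟨ sum-permute elements (injective⇒permutation σ σ-injective) ⟩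
      product (λ i → fsuc (σ i))        ≡⟨ sum-cong-≗ (λ i → fsuc-unsuc (a · fsuc i) (a·x≢0 i)) ⟩
      product (λ i → a · fsuc i)        ≡⟨ product-scale m a elements ⟩
      a ^ m · P                         ∎
      where open ≡.≡-Reasoning

  -- Polynomial functions: a monic polynomial of degree d, given by Horner's scheme.
  Monic : ℕ → (F → F) → Set
  Monic zero f = ∀ x → f x ≡ 1F
  Monic (suc d) f = ∃ λ g → ∃ λ c → Monic d g × (∀ x → f x ≡ x · g x ⊕ c)

  around : ∀ x r → (x - r) ⊕ r ≡ x
  around x r = ≡.trans (⊕-assoc x (⊖ r) r)
    (≡.trans (≡.cong (x ⊕_) (⊖-inverseˡ r)) (+-identityʳ x))

  factor : ∀ d f → Monic (suc d) f → ∀ r →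
           ∃ λ h → Monic d h × (∀ x → f x ≡ (x - r) · h x ⊕ f r)
  factor zero f (g , c , g≡1 , f≡) r = (λ _ → 1F) , (λ _ → ≡.refl) , λ x → begin
    f x                          ≡⟨ f≡ x ⟩
    x · g x ⊕ c                  ≡⟨ ≡.cong₂ (λ u v → u · v ⊕ c) (≡.sym (around x r)) (g≡1 x) ⟩
    ((x - r) ⊕ r) · 1F ⊕ c       ≡⟨ FR.shift-linear (x - r) r 1F c ⟩
    (x - r) · 1F ⊕ (r · 1F ⊕ c)  ≡⟨ ≡.cong (λ u → (x - r) · 1F ⊕ (r · u ⊕ c)) (≡.sym (g≡1 r)) ⟩
    (x - r) · 1F ⊕ (r · g r ⊕ c) ≡⟨ ≡.cong ((x - r) · 1F ⊕_) (≡.sym (f≡ r)) ⟩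
    (x - r) · 1F ⊕ f r           ∎
    where open ≡.≡-Reasoning
  factor (suc d) f (g , c , g-monic , f≡) r with factor d g g-monic r
  ... | h , h-monic , g≡ = (λ x → x · h x ⊕ g r) , (h , g r , h-monic , λ x → ≡.refl) , λ x → begin
    f x                                            ≡⟨ f≡ x ⟩
    x · g x ⊕ c                                    ≡⟨ ≡.cong₂ (λ u v → u · v ⊕ c) (≡.sym (around x r)) (g≡ x) ⟩
    ((x - r) ⊕ r) · ((x - r) · h x ⊕ g r) ⊕ c      ≡⟨ FR.shift-horner (x - r) r (h x) (g r) c ⟩
    (x - r) · (((x - r) ⊕ r) · h x ⊕ g r) ⊕ (r · g r ⊕ c)
      ≡⟨ ≡.cong₂ (λ u v → (x - r) · (u · h x ⊕ g r) ⊕ v) (around x r) (≡.sym (f≡ r)) ⟩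
    (x - r) · (x · h x ⊕ g r) ⊕ f r                ∎
    where open ≡.≡-Reasoning

  root-bound : ∀ d f → Monic d f → (r : Fin (suc d) → F) → (∀ i j → r i ≡ r j → i ≡ j) →
               ¬ (∀ i → f (r i) ≡ 0F)
  root-bound zero f f≡1 r r-inj roots = 1≢0 (≡.trans (≡.sym (f≡1 (r fzero))) (roots fzero))
  root-bound (suc d) f f-monic r r-inj roots with factor d f f-monic (r fzero)
  ... | h , h-monic , f≡ =
    root-bound d h h-monic (λ i → r (fsuc i)) (λ i j e → FinP.suc-injective (r-inj _ _ e)) h-roots
    where
    h-roots : ∀ i → h (r (fsuc i)) ≡ 0F
    h-roots i with no-zero-divisors (r (fsuc i) - r fzero) (h (r (fsuc i))) (begin
      (r (fsuc i) - r fzero) · h (r (fsuc i))        ≡⟨ ≡.sym (+-identityʳ _) ⟩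
      (r (fsuc i) - r fzero) · h (r (fsuc i)) ⊕ 0F   ≡⟨ ≡.cong ((r (fsuc i) - r fzero) · h (r (fsuc i)) ⊕_) (≡.sym (roots fzero)) ⟩
      (r (fsuc i) - r fzero) · h (r (fsuc i)) ⊕ f (r fzero) ≡⟨ ≡.sym (f≡ (r (fsuc i))) ⟩
      f (r (fsuc i))                                 ≡⟨ roots (fsuc i) ⟩
      0F                                             ∎)
      where open ≡.≡-Reasoning
    ... | inj₁ distinct≡0 with r-inj _ _ (FR.difference≈0⇒≈ distinct≡0)
    ...   | ()
    h-roots i | inj₂ h≡0 = h≡0

  ^-monic : ∀ e → Monic e (_^ e)
  ^-monic zero x = ≡.refl
  ^-monic (suc e) = (_^ e) , 0F , ^-monic e , λ x → ≡.sym (+-identityʳ (x · x ^ e))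

  -- x^e = 1 has at most e < m solutions, so some element of 𝔽_p^* is not a root
  non-root : ∀ e → suc e < m → ∃ λ (i : Fin m) → fsuc i ^ suc e ≢ 1F
  non-root e e<m with FinP.any? (λ (i : Fin m) → ¬? (fsuc i ^ suc e FinP.≟ 1F))
  ... | yes found = found
  ... | no none = ⊥-elim (root-bound (suc e) (λ x → x ^ suc e - 1F) x^e-1-monic roots-of-unity distinct all-roots)
    where
    x^e-1-monic : Monic (suc e) (λ x → x ^ suc e - 1F)
    x^e-1-monic = (_^ e) , ⊖ 1F , ^-monic e , λ x → ≡.refl
    roots-of-unity : Fin (suc (suc e)) → F
    roots-of-unity i = fsuc (Fin.inject≤ i e<m)
    distinct : ∀ i j → roots-of-unity i ≡ roots-of-unity j → i ≡ j
    distinct i j eq = FinP.toℕ-injective (≡.trans (≡.sym (FinP.toℕ-inject≤ i e<m))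
      (≡.trans (ℕP.suc-injective (≡.cong toℕ eq)) (FinP.toℕ-inject≤ j e<m)))
    all-roots : ∀ i → roots-of-unity i ^ suc e - 1F ≡ 0F
    all-roots i with roots-of-unity i ^ suc e FinP.≟ 1F
    ... | yes x^e≡1 = FR.≈⇒difference≈0 x^e≡1
    ... | no x^e≢1 = ⊥-elim (none (_ , x^e≢1))

  module _ where
    open import Data.Nat using (_+_; _*_; _%_; _/_; nonTrivial⇒nonZero) renaming (_^_ to _^ℕ_)
    open import Data.Nat.DivMod using (m≡m%n+[m/n]*n; m%n<n)
    open import Data.Nat.Divisibility
      using (_∣_; divides; ∣-refl; ∣-trans; ∣⇒≤; m%n≡0⇒n∣m; n∣m*n; m∣m*n; *-monoʳ-∣; 0∣⇒≡0)
    open import Data.Nat.Coprimality using (Coprime; coprime-divisor) renaming (sym to coprime-sym)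
    open import Data.Nat.Primality using (prime⇒nonTrivial)
    open import Data.Nat.Induction using (<-rec)
    open import Data.Nat.Solver using (module +-*-Solver)
    open +-*-Solver using (solve; _:*_; _:=_)
    open NatFacts

    Order : F → ℕ → Set
    Order x d = x ^ d ≡ 1F × (∀ j → x ^ j ≡ 1F → d ∣ j)

    ^-one-multiple : ∀ x d {j} → x ^ d ≡ 1F → d ∣ j → x ^ j ≡ 1F
    ^-one-multiple x d x^d≡1 (divides q ≡.refl) = begin
      x ^ (q * d)   ≡⟨ ≡.cong (x ^_) (ℕP.*-comm q d) ⟩
      x ^ (d * q)   ≡⟨ FR.pw-* x d q ⟩
      (x ^ d) ^ q   ≡⟨ ≡.cong (_^ q) x^d≡1 ⟩
      1F ^ q        ≡⟨ FR.pw-1 q ⟩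
      1F            ∎
      where open ≡.≡-Reasoning

    -- the least positive exponent with x^d = 1 (it exists by Fermat) is the order
    order-exists : ∀ x → x ≢ 0F → ∃ λ d → Order x d
    order-exists x x≢0 with least-below (λ j → x ^ suc j ≡ 1F) (λ j → x ^ suc j FinP.≟ 1F) m
    ... | inj₂ none = ⊥-elim (none k (ℕP.n<1+n k) (fermat x x≢0))
    ... | inj₁ (j , _ , x^d≡1 , minimal) = d , x^d≡1 , divides-exponent
      where
      d = suc j
      divides-exponent : ∀ i → x ^ i ≡ 1F → d ∣ i
      divides-exponent i x^i≡1 = m%n≡0⇒n∣m i d (remainder≡0 (i % d) (m%n<n i d) x^r≡1)
        where
        x^r≡1 : x ^ (i % d) ≡ 1F
        x^r≡1 = begin
          x ^ (i % d)                     ≡⟨ ≡.sym (*-identityʳ _) ⟩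
          x ^ (i % d) · 1F                ≡⟨ ≡.cong (x ^ (i % d) ·_) (≡.sym (^-one-multiple x d x^d≡1 (n∣m*n (i / d)))) ⟩
          x ^ (i % d) · x ^ (i / d * d)   ≡⟨ ≡.sym (FR.pw-+ x (i % d) (i / d * d)) ⟩
          x ^ (i % d + i / d * d)         ≡⟨ ≡.cong (x ^_) (≡.sym (m≡m%n+[m/n]*n i d)) ⟩
          x ^ i                           ≡⟨ x^i≡1 ⟩
          1F                              ∎
          where open ≡.≡-Reasoning
        remainder≡0 : ∀ r → r < d → x ^ r ≡ 1F → r ≡ 0
        remainder≡0 zero _ _ = ≡.refl
        remainder≡0 (suc r) r<d x^r≡1 = ⊥-elim (minimal r (ℕP.≤-pred r<d) x^r≡1)

    order-* : ∀ {x y a b} → Order x a → Order y b → Coprime a b → Order (x · y) (a * b)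
    order-* {x} {y} {a} {b} (x^a≡1 , x-order) (y^b≡1 , y-order) coprime = xy^ab≡1 , ab∣
      where
      open ≡.≡-Reasoning
      xy^ : ∀ j → (x · y) ^ j ≡ x ^ j · y ^ j
      xy^ = FR.pw-distrib x y
      xy^ab≡1 : (x · y) ^ (a * b) ≡ 1F
      xy^ab≡1 = begin
        (x · y) ^ (a * b)            ≡⟨ xy^ (a * b) ⟩
        x ^ (a * b) · y ^ (a * b)    ≡⟨ ≡.cong₂ _·_ (^-one-multiple x a x^a≡1 (m∣m*n b)) (^-one-multiple y b y^b≡1 (n∣m*n a)) ⟩
        1F · 1F                      ≡⟨ ·-identityˡ 1F ⟩
        1F                           ∎
      ab∣ : ∀ j → (x · y) ^ j ≡ 1F → a * b ∣ j
      ab∣ j xy^j≡1 = a*b∣j a∣j b∣j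
        where
        xy^jt≡1 : ∀ t → (x · y) ^ (j * t) ≡ 1F
        xy^jt≡1 t = ^-one-multiple (x · y) j xy^j≡1 (m∣m*n t)
        -- raising to the power j·b kills y, so x^(jb) = 1 and a ∣ jb
        a∣j : a ∣ j
        a∣j = coprime-divisor coprime (≡.subst (a ∣_) (ℕP.*-comm j b) (x-order (j * b) (begin
          x ^ (j * b)                  ≡⟨ ≡.sym (*-identityʳ _) ⟩
          x ^ (j * b) · 1F             ≡⟨ ≡.cong (x ^ (j * b) ·_) (≡.sym (^-one-multiple y b y^b≡1 (n∣m*n j))) ⟩
          x ^ (j * b) · y ^ (j * b)    ≡⟨ ≡.sym (xy^ (j * b)) ⟩
          (x · y) ^ (j * b)            ≡⟨ xy^jt≡1 b ⟩
          1F                           ∎)))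
        b∣j : b ∣ j
        b∣j = coprime-divisor (coprime-sym coprime) (≡.subst (b ∣_) (ℕP.*-comm j a) (y-order (j * a) (begin
          y ^ (j * a)                  ≡⟨ ≡.sym (·-identityˡ _) ⟩
          1F · y ^ (j * a)             ≡⟨ ≡.cong (_· y ^ (j * a)) (≡.sym (^-one-multiple x a x^a≡1 (n∣m*n j))) ⟩
          x ^ (j * a) · y ^ (j * a)    ≡⟨ ≡.sym (xy^ (j * a)) ⟩
          (x · y) ^ (j * a)            ≡⟨ xy^jt≡1 a ⟩
          1F                           ∎)))
        a*b∣j : a ∣ j → b ∣ j → a * b ∣ j
        a*b∣j (divides t ≡.refl) b∣ta = ≡.subst (a * b ∣_) (ℕP.*-comm a t)
          (*-monoʳ-∣ a (coprime-divisor (coprime-sym coprime) (≡.subst (b ∣_) (ℕP.*-comm t a) b∣ta)))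

    prime-power-order : ∀ x q e → Prime q → x ^ (q ^ℕ suc e) ≡ 1F → x ^ (q ^ℕ e) ≢ 1F →
                        Order x (q ^ℕ suc e)
    prime-power-order x q e q-prime x^Q≡1 x^q^e≢1 with order-exists x x≢0
      where
      x≢0 : x ≢ 0F
      x≢0 ≡.refl = 1≢0 (≡.trans (≡.sym x^Q≡1) (0^Q (q ^ℕ suc e)
        (ℕP.m^n>0 q {{nonTrivial⇒nonZero q {{prime⇒nonTrivial q-prime}}}} (suc e))))
        where
        0^Q : ∀ n → 0 < n → 0F ^ n ≡ 0F
        0^Q (suc n) _ = zeroˡ (0F ^ n)
    ... | d , d-order@(x^d≡1 , x-order) with divisor-of-prime-power e d q-prime (x-order _ x^Q≡1)
    ...   | inj₁ ≡.refl = d-order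
    ...   | inj₂ d∣q^e = ⊥-elim (x^q^e≢1 (^-one-multiple x d x^d≡1 d∣q^e))

    -- for every prime power Q = q^(e+1) dividing m there is an element of order Q:
    -- with m = t·Q, some x has x^(m/q) ≠ 1, and then x^t has order Q
    element-of-prime-power-order : ∀ q e → Prime q → q ^ℕ suc e ∣ m → ∃ λ x → Order x (q ^ℕ suc e)
    element-of-prime-power-order q e q-prime (divides t m≡tQ) = with-M (t * q ^ℕ e) m≡Mq
      where
      Q = q ^ℕ suc e
      m≡Mq : m ≡ (t * q ^ℕ e) * q
      m≡Mq = ≡.trans m≡tQ (solve 3 (λ a b c → a :* (c :* b) := (a :* b) :* c) ≡.refl t (q ^ℕ e) q)
      with-M : ∀ M → m ≡ M * q → ∃ λ x → Order x Q
      with-M zero ()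
      with-M (suc M) m≡Mq′ with non-root M (≡.subst (suc M <_) (≡.sym m≡Mq′) (ℕP.m<m*n (suc M) q (prime>1 q-prime)))
      ... | i , x^M≢1 = x ^ t , prime-power-order (x ^ t) q e q-prime y^Q≡1 y^q^e≢1
        where
        x = fsuc i
        y^Q≡1 : (x ^ t) ^ Q ≡ 1F
        y^Q≡1 = ≡.trans (≡.sym (FR.pw-* x t Q)) (≡.trans (≡.cong (x ^_) (≡.sym m≡tQ)) (fermat x (λ ())))
        y^q^e≢1 : (x ^ t) ^ (q ^ℕ e) ≢ 1F
        y^q^e≢1 y^q^e≡1 = x^M≢1 (≡.trans (≡.cong (x ^_) M≡tq^e) (≡.trans (FR.pw-* x t (q ^ℕ e)) y^q^e≡1))
          where
          instance _ = nonTrivial⇒nonZero q {{prime⇒nonTrivial q-prime}}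
          M≡tq^e : suc M ≡ t * q ^ℕ e
          M≡tq^e = ℕP.*-cancelʳ-≡ (suc M) (t * q ^ℕ e) q (≡.trans (≡.sym m≡Mq′) m≡Mq)

    -- every divisor d of m is the order of some element (strong induction on d):
    -- split off a prime power d = q^(e+1) d′ with q ∤ d′ and multiply
    element-of-order : ∀ d → d ∣ m → ∃ λ x → Order x d
    element-of-order = <-rec _ build
      where
      build : ∀ d → (∀ {d′} → d′ < d → d′ ∣ m → ∃ λ x → Order x d′) → d ∣ m → ∃ λ x → Order x d
      build zero rec 0∣m with 0∣⇒≡0 0∣m
      ... | ()
      build (suc zero) rec _ = 1F , ·-identityˡ 1F , λ j _ → divides j (≡.sym (ℕP.*-identityʳ j))
      build d@(suc (suc _)) rec d∣m with prime-factor d (s≤s (s≤s z≤n))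
      ... | q , q-prime , divides zero ()
      ... | q , q-prime , divides c@(suc _) d≡cq
        with split-power q (prime>1 q-prime) c (s≤s z≤n)
      ... | e , d′ , c≡q^e*d′ , q∤d′ = x · z , ≡.subst (Order (x · z)) (≡.sym d≡Qd′)
              (order-* x-order z-order (coprime-^ (prime-coprime q-prime q∤d′) (suc e)))
        where
        Q = q ^ℕ suc e
        d≡Qd′ : d ≡ Q * d′
        d≡Qd′ = ≡.trans d≡cq (≡.trans (≡.cong (_* q) c≡q^e*d′)
          (solve 3 (λ a b c → (a :* b) :* c := (c :* a) :* b) ≡.refl (q ^ℕ e) d′ q))
        d′<d : d′ < d
        d′<d = ℕP.≤-<-trans (∣⇒≤ (divides (q ^ℕ e) c≡q^e*d′))
               (≡.subst (c <_) (≡.sym d≡cq) (ℕP.m<m*n c q (prime>1 q-prime)))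
        z-and-order = rec d′<d (∣-trans (divides Q d≡Qd′) d∣m)
        z = proj₁ z-and-order
        z-order = proj₂ z-and-order
        x-and-order = element-of-prime-power-order q e q-prime
          (∣-trans (divides d′ (≡.trans d≡Qd′ (ℕP.*-comm Q d′))) d∣m)
        x = proj₁ x-and-order
        x-order = proj₂ x-and-order

    -- 𝔽_p^* is cyclic (kept abstract: only the order of the generator matters)
    abstract
      generator : ∃ λ g → Order g m
      generator = element-of-order m ∣-refl

  module _ where
    open import Data.Nat using (_+_)
    open import Data.Nat.Divisibility using (_∣_)
    open NatFacts using (close-congruent⇒≡)

    g : F
    g = proj₁ generator

    g-order : Order g m
    g-order = proj₂ generator

    g≢0 : g ≢ 0F
    g≢0 g≡0 = 1≢0 (≡.trans (≡.sym (proj₁ g-order)) (≡.cong (_^ m) g≡0))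

    equal-powers : ∀ a b → a ≤ b → g ^ a ≡ g ^ b → m ∣ b ∸ a
    equal-powers a b a≤b g^a≡g^b = proj₂ g-order (b ∸ a)
      (≡.sym (·-cancelˡ (g ^ a) (^-nonzero g a g≢0) (begin
        g ^ a · 1F           ≡⟨ *-identityʳ _ ⟩
        g ^ a                ≡⟨ g^a≡g^b ⟩
        g ^ b                ≡⟨ ≡.cong (g ^_) (≡.sym (ℕP.m+[n∸m]≡n a≤b)) ⟩
        g ^ (a + (b ∸ a))    ≡⟨ FR.pw-+ g a (b ∸ a) ⟩
        g ^ a · g ^ (b ∸ a)  ∎)))
      where open ≡.≡-Reasoning

    powers-injective : ∀ (i j : Fin m) → g ^ toℕ i ≡ g ^ toℕ j → i ≡ j
    powers-injective i j g^i≡g^j with ℕP.≤-total (toℕ i) (toℕ j)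
    ... | inj₁ i≤j = FinP.toℕ-injective (≡.sym
      (close-congruent⇒≡ i≤j (FinP.toℕ<n j) (equal-powers _ _ i≤j g^i≡g^j)))
    ... | inj₂ j≤i = FinP.toℕ-injective
      (close-congruent⇒≡ j≤i (FinP.toℕ<n i) (equal-powers _ _ j≤i (≡.sym g^i≡g^j)))

    private
      power : Fin m → Fin m
      power i = unsuc (g ^ toℕ i) (^-nonzero g (toℕ i) g≢0)

      power-injective : ∀ i j → power i ≡ power j → i ≡ j
      power-injective i j e = powers-injective i j
        (≡.trans (≡.sym (fsuc-unsuc _ _)) (≡.trans (≡.cong fsuc e) (fsuc-unsuc _ _)))

      log-of : ∀ (y : Fin m) → ∃ λ i → power i ≡ y
      log-of = injective⇒surjective power power-injective

    log : F → ℕ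
    log fzero = 0
    log (fsuc y) = toℕ (proj₁ (log-of y))

    log<m : ∀ x → log x < m
    log<m fzero = s≤s z≤n
    log<m (fsuc y) = FinP.toℕ<n (proj₁ (log-of y))

    g^log : ∀ x → x ≢ 0F → g ^ log x ≡ x
    g^log fzero x≢0 = ⊥-elim (x≢0 ≡.refl)
    g^log (fsuc y) _ = ≡.trans (≡.sym (fsuc-unsuc _ _)) (≡.cong fsuc (proj₂ (log-of y)))

  -- The point y(t₁,t₂) = -t₃/(t₁t₂), t₃ = 1 - t₁ - t₂, at which the character sum
  -- of the main computation is evaluated; y = 1 exactly on the lines t₁ = 1, t₂ = 1.
  module _ where
    open import Data.Nat using (_+_)
    open CommutativeRing ring using (-‿inverseʳ)
    open import Algebra.Properties.Ring (CommutativeRing.ring ring) using (-1*x≈-x; -‿involutive)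
    open import Algebra.Properties.Group (CommutativeRing.+-group ring) using (inverseˡ-unique)
    open ≡.≡-Reasoning

    -1F : F
    -1F = ⊖ 1F

    -1·-1 : -1F · -1F ≡ 1F
    -1·-1 = ≡.trans (-1*x≈-x -1F) (-‿involutive 1F)

    -1·x≡⊖x : ∀ x → -1F · x ≡ ⊖ x
    -1·x≡⊖x = -1*x≈-x

    -1≢0 : -1F ≢ 0F
    -1≢0 -1≡0 = 1≢0 (≡.trans (≡.sym -1·-1) (≡.trans (≡.cong (λ u → u · u) -1≡0) (zeroˡ 0F)))

    -- Defs.Fp.oneMinus
    t₃ : F → F → F
    t₃ s t = [ suc ((p ∸ toℕ s) + (p ∸ toℕ t)) ]

    t₃≡ : ∀ s t → t₃ s t ≡ 1F ⊕ ⊖ s ⊕ ⊖ t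
    t₃≡ s t = ≡.trans ([]-+ 1 ((p ∸ toℕ s) + (p ∸ toℕ t)))
      (≡.trans (≡.cong (1F ⊕_) ([]-+ (p ∸ toℕ s) (p ∸ toℕ t))) (≡.sym (⊕-assoc 1F (⊖ s) (⊖ t))))

    t₃-1ˡ : ∀ t → t₃ 1F t ≡ ⊖ t
    t₃-1ˡ t = ≡.trans (t₃≡ 1F t) (≡.trans (≡.cong (_⊕ ⊖ t) (-‿inverseʳ 1F)) (⊕-identityˡ (⊖ t)))

    t₃-1ʳ : ∀ s → t₃ s 1F ≡ ⊖ s
    t₃-1ʳ s = ≡.trans (≡.cong (λ n → [ suc n ]) (ℕP.+-comm (p ∸ toℕ s) (p ∸ 1))) (t₃-1ˡ s)

    y : F → F → F
    y t₁ t₂ = -1F · t₁ ^ k · t₂ ^ k · t₃ t₁ t₂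

    y≢0 : ∀ t₁ t₂ → t₁ ≢ 0F → t₂ ≢ 0F → t₃ t₁ t₂ ≢ 0F → y t₁ t₂ ≢ 0F
    y≢0 t₁ t₂ t₁≢0 t₂≢0 t₃≢0 =
      ·-nonzero { -1F · t₁ ^ k · t₂ ^ k} {t₃ t₁ t₂}
        (·-nonzero { -1F · t₁ ^ k} {t₂ ^ k} (·-nonzero { -1F} {t₁ ^ k} -1≢0 (^-nonzero t₁ k t₁≢0))
          (^-nonzero t₂ k t₂≢0)) t₃≢0

    -- t^k = t⁻¹ by Fermat
    ^k-inverse : ∀ t → t ≢ 0F → t ^ k · t ≡ 1F
    ^k-inverse t t≢0 = ≡.trans (·-comm (t ^ k) t) (fermat t t≢0)

    y-equation : ∀ t₁ t₂ → t₁ ≢ 0F → t₂ ≢ 0F → y t₁ t₂ · (t₁ · t₂) ≡ ⊖ t₃ t₁ t₂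
    y-equation t₁ t₂ t₁≢0 t₂≢0 = begin
      y t₁ t₂ · (t₁ · t₂)                           ≡⟨ FR.pair-factors -1F (t₁ ^ k) (t₂ ^ k) t₁ t₂ (t₃ t₁ t₂) ⟩
      -1F · (t₁ ^ k · t₁) · (t₂ ^ k · t₂) · t₃ t₁ t₂  ≡⟨ ≡.cong₂ (λ u v → -1F · u · v · t₃ t₁ t₂) (^k-inverse t₁ t₁≢0) (^k-inverse t₂ t₂≢0) ⟩
      -1F · 1F · 1F · t₃ t₁ t₂                      ≡⟨ ≡.cong (_· t₃ t₁ t₂) (≡.trans (*-identityʳ (-1F · 1F)) (*-identityʳ -1F)) ⟩
      -1F · t₃ t₁ t₂                                ≡⟨ -1*x≈-x (t₃ t₁ t₂) ⟩
      ⊖ t₃ t₁ t₂                                    ∎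

    lines-equation : ∀ t₁ t₂ → (t₁ - 1F) · (t₂ - 1F) ≡ t₁ · t₂ ⊕ t₃ t₁ t₂
    lines-equation t₁ t₂ = begin
      (t₁ ⊕ -1F) · (t₂ ⊕ -1F)                          ≡⟨ FR.expand t₁ t₂ -1F ⟩
      t₁ · t₂ ⊕ (-1F · -1F ⊕ -1F · t₁ ⊕ -1F · t₂)       ≡⟨ ≡.cong (t₁ · t₂ ⊕_) (≡.cong₂ _⊕_
                                                          (≡.cong₂ _⊕_ -1·-1 (-1*x≈-x t₁)) (-1*x≈-x t₂)) ⟩
      t₁ · t₂ ⊕ (1F ⊕ ⊖ t₁ ⊕ ⊖ t₂)                     ≡⟨ ≡.cong (t₁ · t₂ ⊕_) (≡.sym (t₃≡ t₁ t₂)) ⟩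
      t₁ · t₂ ⊕ t₃ t₁ t₂                               ∎

    -- y = 1 ⟺ t₁ t₂ = -t₃ ⟺ (t₁ - 1)(t₂ - 1) = 0
    on-a-line⇒y≡1 : ∀ t₁ t₂ → t₁ ≢ 0F → t₂ ≢ 0F → t₁ ≡ 1F ⊎ t₂ ≡ 1F → y t₁ t₂ ≡ 1F
    on-a-line⇒y≡1 t₁ t₂ t₁≢0 t₂≢0 on-line = ·-cancelˡ (t₁ · t₂) (·-nonzero t₁≢0 t₂≢0) (begin
      t₁ · t₂ · y t₁ t₂   ≡⟨ ·-comm (t₁ · t₂) (y t₁ t₂) ⟩
      y t₁ t₂ · (t₁ · t₂) ≡⟨ y-equation t₁ t₂ t₁≢0 t₂≢0 ⟩
      ⊖ t₃ t₁ t₂          ≡⟨ ≡.sym (inverseˡ-unique (t₁ · t₂) (t₃ t₁ t₂) (≡.trans (≡.sym (lines-equation t₁ t₂)) (vanishes on-line))) ⟩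
      t₁ · t₂             ≡⟨ ≡.sym (*-identityʳ (t₁ · t₂)) ⟩
      t₁ · t₂ · 1F        ∎)
      where
      vanishes : t₁ ≡ 1F ⊎ t₂ ≡ 1F → (t₁ - 1F) · (t₂ - 1F) ≡ 0F
      vanishes (inj₁ t₁≡1) = ≡.trans (≡.cong (λ t → (t - 1F) · (t₂ - 1F)) t₁≡1)
        (≡.trans (≡.cong (_· (t₂ - 1F)) (-‿inverseʳ 1F)) (zeroˡ (t₂ - 1F)))
      vanishes (inj₂ t₂≡1) = ≡.trans (≡.cong (λ t → (t₁ - 1F) · (t - 1F)) t₂≡1)
        (≡.trans (≡.cong ((t₁ - 1F) ·_) (-‿inverseʳ 1F)) (zeroʳ (t₁ - 1F)))

    y≡1⇒on-a-line : ∀ t₁ t₂ → t₁ ≢ 0F → t₂ ≢ 0F → y t₁ t₂ ≡ 1F → t₁ ≡ 1F ⊎ t₂ ≡ 1F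
    y≡1⇒on-a-line t₁ t₂ t₁≢0 t₂≢0 y≡1 =
      Sum.map FR.difference≈0⇒≈ FR.difference≈0⇒≈ (no-zero-divisors (t₁ - 1F) (t₂ - 1F) (begin
        (t₁ - 1F) · (t₂ - 1F)   ≡⟨ lines-equation t₁ t₂ ⟩
        t₁ · t₂ ⊕ t₃ t₁ t₂      ≡⟨ ≡.cong (_⊕ t₃ t₁ t₂) t₁t₂≡-t₃ ⟩
        ⊖ t₃ t₁ t₂ ⊕ t₃ t₁ t₂   ≡⟨ ⊖-inverseˡ (t₃ t₁ t₂) ⟩
        0F                      ∎))
      where
      t₁t₂≡-t₃ : t₁ · t₂ ≡ ⊖ t₃ t₁ t₂
      t₁t₂≡-t₃ = ≡.trans (≡.sym (≡.trans (≡.cong (_· (t₁ · t₂)) y≡1) (·-identityˡ (t₁ · t₂))))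
                         (y-equation t₁ t₂ t₁≢0 t₂≢0)

module Characters {c ℓ} (R : CommutativeRing c ℓ) (domain : IsIntegralDomain R)
                  (k : ℕ) (p-prime : Prime (suc (suc k)))
                  (ζ : CommutativeRing.Carrier R) (ζ-primitive : IsPrimitiveRoot R (suc k) ζ) where
  open CommutativeRing R
  open RingFacts R
  open DomainFacts R domain
  open PrimeField k p-prime using (F; 0F; 1F; _·_; m; p; g; g≢0; log; log<m; g^log; equal-powers;
    ·-nonzero; ·-cancelˡ; x·0≡0; 1≢0; ^-+) renaming (_^_ to _^F_)
  open Fp R p using (IsCharacter; triv; _⊗_; EnumeratesCharacters; chPow)
  open import Data.Integer using (ℤ; +_; -[1+_])
  open import Data.Nat.Divisibility using (_∣_; divides)
  open import Relation.Binary.Reasoning.Setoid setoid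

  triv-nonzero : ∀ x → x ≢ 0F → triv x ≈ 1#
  triv-nonzero fzero x≢0 = ⊥-elim (x≢0 ≡.refl)
  triv-nonzero (fsuc x) _ = refl

  triv-character : IsCharacter triv
  triv-character = refl , refl , multiplicative
    where
    multiplicative : ∀ x y → triv (x · y) ≈ triv x * triv y
    multiplicative fzero y = sym (zeroˡ _)
    multiplicative (fsuc x) fzero = trans (reflexive (≡.cong triv (x·0≡0 (fsuc x)))) (sym (zeroʳ _))
    multiplicative (fsuc x) (fsuc y) =
      trans (triv-nonzero _ (·-nonzero {fsuc x} {fsuc y} (λ ()) (λ ()))) (sym (*-identityˡ 1#))

  ∑-triv : ∑ R p triv ≈ fromℕ R m
  ∑-triv = trans (+-identityˡ _) (∑-ones m)

  ⊗-character : ∀ {φ χ} → IsCharacter φ → IsCharacter χ → IsCharacter (φ ⊗ χ)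
  ⊗-character (φ0 , φ1 , φ·) (χ0 , χ1 , χ·) = trans (*-congʳ φ0) (zeroˡ _) ,
    trans (*-cong φ1 χ1) (*-identityˡ 1#) ,
    λ x y → trans (*-cong (φ· x y) (χ· x y)) (*-interchange _ _ _ _)

  module _ {φ : F → Carrier} (φ-character : IsCharacter φ) where
    private
      φ-1 = proj₁ (proj₂ φ-character)
      φ-· = proj₂ (proj₂ φ-character)

    character-^ : ∀ x a → φ (x ^F a) ≈ pw R (φ x) a
    character-^ x zero = φ-1
    character-^ x (suc a) = trans (φ-· x (x ^F a)) (*-congˡ (character-^ x a))

    character-log : ∀ x → x ≢ 0F → φ x ≈ pw R (φ g) (log x)
    character-log x x≢0 = trans (reflexive (≡.cong φ (≡.sym (g^log x x≢0)))) (character-^ g (log x))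

    triv-absorbs : ∀ x → triv x * φ x ≈ φ x
    triv-absorbs fzero = trans (zeroˡ _) (sym (proj₁ φ-character))
    triv-absorbs (fsuc x) = *-identityˡ _

    trivial-at-g⇒trivial : φ g ≈ 1# → ∀ x → φ x ≈ triv x
    trivial-at-g⇒trivial φg≈1 fzero = proj₁ φ-character
    trivial-at-g⇒trivial φg≈1 (fsuc x) = trans (character-log (fsuc x) (λ ()))
      (trans (pw-cong (log (fsuc x)) φg≈1) (pw-1 (log (fsuc x))))

    -- first orthogonality relation: a nontrivial character sums to 0 over 𝔽_p,
    -- as multiplication by x₀ permutes 𝔽_p
    character-sum-vanishes : ∀ x₀ → x₀ ≢ 0F → ¬ (φ x₀ ≈ 1#) → ∑ R p φ ≈ 0#
    character-sum-vanishes x₀ x₀≢0 φx₀≉1 = fixed⇒0 φx₀≉1 (sym (begin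
      ∑ R p φ                     ≈⟨ sym (∑-reindex p (x₀ ·_) (λ i j → ·-cancelˡ x₀ x₀≢0) φ) ⟩
      ∑ R p (λ t → φ (x₀ · t))    ≈⟨ ∑-cong p (φ-· x₀) ⟩
      ∑ R p (λ t → φ x₀ * φ t)    ≈⟨ ∑-*ˡ p (φ x₀) φ ⟩
      φ x₀ * ∑ R p φ              ∎))

  -- The character sending g to ζ; it separates the points of 𝔽_p^*.
  module _ where
    private
      ζ^m≈1 : pw R ζ m ≈ 1#
      ζ^m≈1 = proj₁ ζ-primitive

    ζ≉0 : ¬ (ζ ≈ 0#)
    ζ≉0 ζ≈0 = 1≉0 (trans (sym ζ^m≈1) (trans (*-congʳ ζ≈0) (zeroˡ _)))

    ζ^-nonzero : ∀ j → ¬ (pw R ζ j ≈ 0#)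
    ζ^-nonzero zero = 1≉0
    ζ^-nonzero (suc j) = *-nonzero ζ≉0 (ζ^-nonzero j)

    ζ^-congruent : ∀ a b → a ≤ b → m ∣ b ∸ a → pw R ζ b ≈ pw R ζ a
    ζ^-congruent a b a≤b (divides q b-a≡qm) = begin
      pw R ζ b                      ≡⟨ ≡.cong (pw R ζ) (≡.sym (ℕP.m+[n∸m]≡n a≤b)) ⟩
      pw R ζ (a ℕ.+ (b ∸ a))          ≈⟨ pw-+ ζ a (b ∸ a) ⟩
      pw R ζ a * pw R ζ (b ∸ a)     ≡⟨ ≡.cong (λ e → pw R ζ a * pw R ζ e) (≡.trans b-a≡qm (ℕP.*-comm q m)) ⟩
      pw R ζ a * pw R ζ (m ℕ.* q)     ≈⟨ *-congˡ (trans (pw-* ζ m q) (trans (pw-cong q ζ^m≈1) (pw-1 q))) ⟩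
      pw R ζ a * 1#                 ≈⟨ *-identityʳ _ ⟩
      pw R ζ a                      ∎

    -- hence g^a ↦ ζ^a is well defined
    g^≡⇒ζ^≈ : ∀ a b → g ^F a ≡ g ^F b → pw R ζ a ≈ pw R ζ b
    g^≡⇒ζ^≈ a b g^a≡g^b with ℕP.≤-total a b
    ... | inj₁ a≤b = sym (ζ^-congruent a b a≤b (equal-powers a b a≤b g^a≡g^b))
    ... | inj₂ b≤a = ζ^-congruent b a b≤a (equal-powers b a b≤a (≡.sym g^a≡g^b))

    χ₁ : F → Carrier
    χ₁ fzero = 0#
    χ₁ (fsuc x) = pw R ζ (log (fsuc x))

    χ₁-log : ∀ x → x ≢ 0F → χ₁ x ≡ pw R ζ (log x)
    χ₁-log fzero x≢0 = ⊥-elim (x≢0 ≡.refl)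
    χ₁-log (fsuc x) _ = ≡.refl

    χ₁-nonzero : ∀ x → x ≢ 0F → ¬ (χ₁ x ≈ 0#)
    χ₁-nonzero x x≢0 χ₁x≈0 = ζ^-nonzero (log x) (trans (reflexive (≡.sym (χ₁-log x x≢0))) χ₁x≈0)

    -- χ₁ is multiplicative since log is additive modulo m
    χ₁-character : IsCharacter χ₁
    χ₁-character = refl , g^≡⇒ζ^≈ (log 1F) 0 (g^log 1F 1≢0) , multiplicative
      where
      multiplicative : ∀ x y → χ₁ (x · y) ≈ χ₁ x * χ₁ y
      multiplicative fzero y = sym (zeroˡ _)
      multiplicative (fsuc x) fzero = trans (reflexive (≡.cong χ₁ (x·0≡0 (fsuc x)))) (sym (zeroʳ _))
      multiplicative x@(fsuc _) y@(fsuc _) = begin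
        χ₁ (x · y)                        ≡⟨ χ₁-log (x · y) xy≢0 ⟩
        pw R ζ (log (x · y))              ≈⟨ g^≡⇒ζ^≈ (log (x · y)) (log x ℕ.+ log y) log-additive ⟩
        pw R ζ (log x ℕ.+ log y)            ≈⟨ pw-+ ζ (log x) (log y) ⟩
        pw R ζ (log x) * pw R ζ (log y)   ∎
        where
        xy≢0 = ·-nonzero {x} {y} (λ ()) (λ ())
        log-additive : g ^F log (x · y) ≡ g ^F (log x ℕ.+ log y)
        log-additive = ≡.trans (g^log (x · y) xy≢0) (≡.sym (≡.trans (^-+ g (log x) (log y))
          (≡.cong₂ _·_ (g^log x (λ ())) (g^log y (λ ())))))

    -- ζ^(log x) = 1 with log x < m forces log x = 0, i.e. x = g^0 = 1
    χ₁≈1⇒≡1 : ∀ x → x ≢ 0F → χ₁ x ≈ 1# → x ≡ 1F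
    χ₁≈1⇒≡1 x x≢0 χ₁x≈1 = ≡.trans (≡.sym (g^log x x≢0)) (≡.cong (g ^F_) (log≡0 (log x) (log<m x)
      (trans (reflexive (≡.sym (χ₁-log x x≢0))) χ₁x≈1)))
      where
      log≡0 : ∀ j → j < m → pw R ζ j ≈ 1# → j ≡ 0
      log≡0 zero _ _ = ≡.refl
      log≡0 (suc j) j<m ζ^j≈1 = ⊥-elim (proj₂ ζ-primitive (suc j) (s≤s z≤n) j<m ζ^j≈1)

  module Enumerated (n : ℕ) (cs : Fin n → F → Carrier) (enumerates : EnumeratesCharacters n cs) where
    cs-character = proj₁ enumerates
    cs-injective = proj₁ (proj₂ enumerates)
    cs-onto = proj₂ (proj₂ enumerates)

    -- second orthogonality relation: Σ_χ χ(y) = 0 for y ∉ {0, 1}, since multiplying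
    -- by χ₁ permutes the characters while χ₁(y) ≠ 1
    sum-over-characters-vanishes : ∀ y → y ≢ 0F → y ≢ 1F → ∑ R n (λ i → cs i y) ≈ 0#
    sum-over-characters-vanishes y y≢0 y≢1 =
      fixed⇒0 (λ χ₁y≈1 → y≢1 (χ₁≈1⇒≡1 y y≢0 χ₁y≈1)) (sym (begin
        ∑ R n (λ i → cs i y)           ≈⟨ sym (∑-reindex n σ σ-injective (λ i → cs i y)) ⟩
        ∑ R n (λ i → cs (σ i) y)       ≈⟨ ∑-cong n (λ i → sym (σ-spec i y)) ⟩
        ∑ R n (λ i → cs i y * χ₁ y)    ≈⟨ ∑-*ʳ n (χ₁ y) (λ i → cs i y) ⟩
        ∑ R n (λ i → cs i y) * χ₁ y    ≈⟨ *-comm _ _ ⟩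
        χ₁ y * ∑ R n (λ i → cs i y)    ∎))
      where
      σ : Fin n → Fin n
      σ i = proj₁ (cs-onto (cs i ⊗ χ₁) (⊗-character (cs-character i) χ₁-character))
      σ-spec : ∀ i x → cs i x * χ₁ x ≈ cs (σ i) x
      σ-spec i = proj₂ (cs-onto (cs i ⊗ χ₁) (⊗-character (cs-character i) χ₁-character))
      σ-injective : ∀ i j → σ i ≡ σ j → i ≡ j
      σ-injective i j σi≡σj = cs-injective i j agree
        where
        agree : ∀ x → cs i x ≈ cs j x
        agree fzero = trans (proj₁ (cs-character i)) (sym (proj₁ (cs-character j)))
        agree x@(fsuc _) = *-cancelʳ (χ₁-nonzero x (λ ()))
          (trans (σ-spec i x) (trans (reflexive (≡.cong (λ l → cs l x) σi≡σj)) (sym (σ-spec j x))))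

    -- the number of characters is p - 1: count Σ_t Σ_χ χ(t) in both orders
    number-of-characters : ∑ R n (λ i → cs i 1F) ≈ fromℕ R m
    number-of-characters = begin
      ∑ R n (λ i → cs i 1F)                     ≈⟨ sym (∑-single p 1F (λ t → ∑ R n (λ i → cs i t)) by-element) ⟩
      ∑ R p (λ t → ∑ R n (λ i → cs i t))        ≈⟨ ∑-comm p n (λ t i → cs i t) ⟩
      ∑ R n (λ i → ∑ R p (cs i))                ≈⟨ ∑-single n i₀ (λ i → ∑ R p (cs i)) by-character ⟩
      ∑ R p (cs i₀)                             ≈⟨ ∑-cong p (λ t → sym (i₀-trivial t)) ⟩
      ∑ R p triv                                ≈⟨ ∑-triv ⟩
      fromℕ R m                                 ∎
      where
      i₀ = proj₁ (cs-onto triv triv-character)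
      i₀-trivial : ∀ t → triv t ≈ cs i₀ t
      i₀-trivial = proj₂ (cs-onto triv triv-character)
      by-element : ∀ t → t ≢ 1F → ∑ R n (λ i → cs i t) ≈ 0#
      by-element fzero _ = ∑-zero n (λ i → proj₁ (cs-character i))
      by-element t@(fsuc _) t≢1 = sum-over-characters-vanishes t (λ ()) t≢1
      -- a character other than the trivial one is nontrivial at the generator
      by-character : ∀ i → i ≢ i₀ → ∑ R p (cs i) ≈ 0#
      by-character i i≢i₀ = character-sum-vanishes (cs-character i) g g≢0 λ csig≈1 →
        i≢i₀ (cs-injective i i₀ (λ t → trans (trivial-at-g⇒trivial (cs-character i) csig≈1 t) (i₀-trivial t)))

  -- Integer powers (Defs.Fp.chPow) of a character: the exponent -(n+1) acts as k(n+1),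
  -- k = p - 2 representing -1 modulo p - 1.
  exponent : ℤ → ℕ
  exponent (+ n) = n
  exponent -[1+ n ] = k ℕ.* suc n

  chPow-exponent : ∀ φ z x → chPow φ z x ≈ chPow φ (+ exponent z) x
  chPow-exponent φ (+ n) x = refl
  chPow-exponent φ -[1+ n ] x = *-congˡ (sym (pw-* (φ x) k (suc n)))

  triv-idempotent : ∀ x → triv x * triv x ≈ triv x
  triv-idempotent fzero = zeroˡ _
  triv-idempotent (fsuc x) = *-identityˡ 1#

  module _ {φ : F → Carrier} (φ-character : IsCharacter φ) where
    power-character : ∀ e → IsCharacter (chPow φ (+ e))
    power-character e = zeroˡ _ ,
      trans (*-identityˡ _) (trans (pw-cong e (proj₁ (proj₂ φ-character))) (pw-1 e)) ,
      λ x y → trans (*-cong (proj₂ (proj₂ triv-character) x y)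
                       (trans (pw-cong e (proj₂ (proj₂ φ-character) x y)) (pw-distrib _ _ e)))
                    (*-interchange _ _ _ _)

    chPow-character : ∀ z → IsCharacter (chPow φ z)
    chPow-character z = respects (chPow-exponent φ z) (power-character (exponent z))
      where
      respects : ∀ {χ χ′} → (∀ x → χ x ≈ χ′ x) → IsCharacter χ′ → IsCharacter χ
      respects χ≈χ′ (χ′0 , χ′1 , χ′·) = trans (χ≈χ′ 0F) χ′0 , trans (χ≈χ′ 1F) χ′1 ,
        λ x y → trans (χ≈χ′ (x · y)) (trans (χ′· x y) (sym (*-cong (χ≈χ′ x) (χ≈χ′ y))))

    chPow-product : ∀ a b x → chPow φ a x * chPow φ b x ≈ chPow φ (+ (exponent a ℕ.+ exponent b)) x
    chPow-product a b x = begin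
      chPow φ a x * chPow φ b x                               ≈⟨ *-cong (chPow-exponent φ a x) (chPow-exponent φ b x) ⟩
      (triv x * pw R (φ x) ea) * (triv x * pw R (φ x) eb)     ≈⟨ *-interchange _ _ _ _ ⟩
      (triv x * triv x) * (pw R (φ x) ea * pw R (φ x) eb)     ≈⟨ *-cong (triv-idempotent x) (sym (pw-+ (φ x) ea eb)) ⟩
      triv x * pw R (φ x) (ea ℕ.+ eb)                         ∎
      where ea = exponent a; eb = exponent b

module OrderFive {c ℓ} (R : CommutativeRing c ℓ) (domain : IsIntegralDomain R)
                 (k : ℕ) (p-prime : Prime (suc (suc k)))
                 (ζ : CommutativeRing.Carrier R) (ζ-primitive : IsPrimitiveRoot R (suc k) ζ)
                 (5∣p-1 : 5 ∣ℕ suc k)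
                 (ψ : Fin (suc (suc k)) → CommutativeRing.Carrier R)
                 (ψ-character : Fp.IsCharacter R (suc (suc k)) ψ) (ψ-order : Fp.HasOrder R (suc (suc k)) ψ 5)
                 where
  open CommutativeRing R
  open RingFacts R
  open DomainFacts R domain
  open Characters R domain k p-prime ζ ζ-primitive
  open PrimeField k p-prime using (F; 0F; 1F; _·_; ⊖_; p; g; g≢0; -1F; -1≢0; -1·-1; -1·x≡⊖x)
  open Fp R p using (triv; chPow)
  open import Data.Integer as ℤ using (ℤ; +_; -[1+_])
  open import Data.Integer.Divisibility using (_∣_)
  import Data.Integer.Divisibility.Signed as ℤ∣
  import Data.Integer.Properties as ℤP
  open import Data.Nat.Divisibility using (divides)
  open import Relation.Binary.Reasoning.Setoid setoid

  ψ^5≈1 : ∀ x → x ≢ 0F → pw R (ψ x) 5 ≈ 1#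
  ψ^5≈1 x x≢0 = trans (sym (*-identityˡ _)) (trans (*-congʳ (sym (triv-nonzero x x≢0)))
    (trans (proj₁ ψ-order x) (triv-nonzero x x≢0)))

  -- ψ(g)^r = 1 for some 0 < r < 5 would make ψ^r trivial
  ψg^r≉1 : ∀ r → 0 < r → r < 5 → ¬ (pw R (ψ g) r ≈ 1#)
  ψg^r≉1 r 0<r r<5 ψg^r≈1 = proj₂ ψ-order r 0<r r<5
    (trivial-at-g⇒trivial (power-character ψ-character r)
      (trans (*-cong (triv-nonzero g g≢0) ψg^r≈1) (*-identityˡ 1#)))

  ψg^j≈1⇒5∣j : ∀ j → pw R (ψ g) j ≈ 1# → 5 ∣ℕ j
  ψg^j≈1⇒5∣j = order-divides (ψ g) 5 (ψ^5≈1 g g≢0) ψg^r≉1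

  -- ψ(-1)² = ψ(1) = 1 and ψ(-1)⁵ = 1 give ψ(-1) = 1
  ψ-1≈1 : ψ -1F ≈ 1#
  ψ-1≈1 = begin
    u                   ≈⟨ sym (*-identityʳ u) ⟩
    u * 1#              ≈⟨ *-congˡ (sym (trans (pw-cong 2 u²≈1) (pw-1 2))) ⟩
    u * pw R (pw R u 2) 2 ≈⟨ *-congˡ (sym (pw-* u 2 2)) ⟩
    pw R u 5            ≈⟨ ψ^5≈1 -1F -1≢0 ⟩
    1#                  ∎
    where
    u = ψ -1F
    u²≈1 : pw R u 2 ≈ 1#
    u²≈1 = trans (*-congˡ (*-identityʳ u)) (trans (sym (proj₂ (proj₂ ψ-character) -1F -1F))
      (trans (reflexive (≡.cong ψ -1·-1)) (proj₁ (proj₂ ψ-character))))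

  chPow-at-1 : ∀ z → chPow ψ z -1F ≈ 1#
  chPow-at-1 z = trans (chPow-exponent ψ z -1F) (trans (*-cong (triv-nonzero -1F -1≢0)
    (trans (pw-cong (exponent z) ψ-1≈1) (pw-1 (exponent z)))) (*-identityˡ 1#))

  chPow-even : ∀ z t → chPow ψ z (⊖ t) ≈ chPow ψ z t
  chPow-even z t = begin
    chPow ψ z (⊖ t)                  ≡⟨ ≡.cong (chPow ψ z) (≡.sym (-1·x≡⊖x t)) ⟩
    chPow ψ z (-1F · t)              ≈⟨ proj₂ (proj₂ (chPow-character ψ-character z)) -1F t ⟩
    chPow ψ z -1F * chPow ψ z t      ≈⟨ *-congʳ (chPow-at-1 z) ⟩
    1# * chPow ψ z t                 ≈⟨ *-identityˡ _ ⟩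
    chPow ψ z t                      ∎

  -- exponent z ≡ z (mod 5), as k ≡ -1 (mod 5)
  exponent-congruent : ∀ z → + 5 ℤ∣.∣ (+ exponent z ℤ.- z)
  exponent-congruent (+ n) = ℤ∣.divides (+ 0) (ℤP.+-inverseʳ (+ n))
  exponent-congruent -[1+ n ] = ℤ∣.∣ᵤ⇒∣ (divides (q ℕ.* suc n) (≡.trans (ℕP.+-comm (k ℕ.* suc n) (suc n))
    (≡.trans (≡.cong (ℕ._* suc n) p-1≡q5)
      (solve 2 (λ q s → q :* con 5 :* s := q :* s :* con 5) ≡.refl q (suc n)))))
    where open import Data.Nat.Solver using (module +-*-Solver)
          open +-*-Solver
          open _∣ℕ_ 5∣p-1 renaming (quotient to q; equality to p-1≡q5)

  exponents-congruent : ∀ b c → 5 ∣ℕ exponent b ℕ.+ exponent c → + 5 ∣ (b ℤ.+ c)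
  exponents-congruent b c 5∣eb+ec = ℤ∣.∣⇒∣ᵤ (≡.subst (+ 5 ℤ∣.∣_) difference
    (ℤ∣.∣m∣n⇒∣m-n (ℤ∣.∣ᵤ⇒∣ {+ 5} {+ (eb ℕ.+ ec)} 5∣eb+ec)
                  (ℤ∣.∣m∣n⇒∣m+n (exponent-congruent b) (exponent-congruent c))))
    where
    open import Data.Integer.Solver using (module +-*-Solver)
    open +-*-Solver
    eb = exponent b
    ec = exponent c
    difference : (+ eb ℤ.+ + ec) ℤ.- ((+ eb ℤ.- b) ℤ.+ (+ ec ℤ.- c)) ≡ b ℤ.+ c
    difference = solve 4 (λ x y b c → (x :+ y) :- ((x :- b) :+ (y :- c)) := b :+ c) ≡.refl (+ eb) (+ ec) b c

  sum-of-product-vanishes : ∀ b c → ¬ (+ 5 ∣ (b ℤ.+ c)) →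
                            ∑ R p (λ t → chPow ψ b t * chPow ψ c t) ≈ 0#
  sum-of-product-vanishes b c 5∤b+c = trans (∑-cong p (chPow-product ψ-character b c))
    (character-sum-vanishes (power-character ψ-character e) g g≢0 nontrivial)
    where
    e = exponent b ℕ.+ exponent c
    nontrivial : ¬ (chPow ψ (+ e) g ≈ 1#)
    nontrivial ψ^e[g]≈1 = 5∤b+c (exponents-congruent b c (ψg^j≈1⇒5∣j e
      (trans (sym (*-identityˡ _)) (trans (*-congʳ (sym (triv-nonzero g g≢0))) ψ^e[g]≈1))))

module CharacterSumOfJacobiSums
  {c ℓ} (R : CommutativeRing c ℓ) (domain : IsIntegralDomain R)
  (k : ℕ) (p-prime : Prime (suc (suc k)))
  (ζ : CommutativeRing.Carrier R) (ζ-primitive : IsPrimitiveRoot R (suc k) ζ) (5∣p-1 : 5 ∣ℕ suc k)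
  (ψ : Fin (suc (suc k)) → CommutativeRing.Carrier R)
  (ψ-character : Fp.IsCharacter R (suc (suc k)) ψ) (ψ-order : Fp.HasOrder R (suc (suc k)) ψ 5)
  (a b c′ : ℤ) (5∤a+c : ¬ (ℤ.+ 5 ∣ℤ (a ℤ.+ c′))) (5∤b+c : ¬ (ℤ.+ 5 ∣ℤ (b ℤ.+ c′)))
  (n : ℕ) (cs : Fin n → Fin (suc (suc k)) → CommutativeRing.Carrier R)
  (enumerates : Fp.EnumeratesCharacters R (suc (suc k)) n cs)
  where
  open CommutativeRing R
  open RingFacts R
  open Characters R domain k p-prime ζ ζ-primitive
  open Enumerated n cs enumerates
  open OrderFive R domain k p-prime ζ ζ-primitive 5∣p-1 ψ ψ-character ψ-order
  open PrimeField k p-prime using (F; 0F; 1F; _·_; ⊖_; m; p; -1F; t₃; t₃-1ˡ; t₃-1ʳ; y; y≢0;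
    on-a-line⇒y≡1; y≡1⇒on-a-line; 1≢0; x·0≡0) renaming (_^_ to _^F_)
  open Fp R p using (triv; chPow; conj; _⊗_; J₃)
  open import Relation.Binary.Reasoning.Setoid setoid

  A B C : F → Carrier
  A = chPow ψ a
  B = chPow ψ b
  C = chPow ψ c′

  -- K(t₁,t₂) = ψ^a(t₁) ψ^b(t₂) ψ^c(t₃), made to vanish when t₁t₂t₃ = 0
  K : F → F → Carrier
  K t₁ t₂ = (triv t₁ * triv t₂) * ((A t₁ * B t₂) * C (t₃ t₁ t₂))

  summand : (F → Carrier) → Carrier
  summand χ = χ -1F * J₃ (conj χ ⊗ A) (conj χ ⊗ B) (χ ⊗ C)

  factors : Fin n → F → F → Carrier
  factors i t₁ t₂ = (conj (cs i) ⊗ A) t₁ * (conj (cs i) ⊗ B) t₂ * (cs i ⊗ C) (t₃ t₁ t₂)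

  -- χ(-1) χ̄(t₁) χ̄(t₂) χ(t₃) = χ(y(t₁,t₂)), and the rest of the term is K(t₁,t₂)
  summand-term : ∀ i t₁ t₂ → cs i -1F * factors i t₁ t₂ ≈ K t₁ t₂ * cs i (y t₁ t₂)
  summand-term i t₁ t₂ = begin
    χ -1F * ((triv t₁ * U₁ * A t₁) * (triv t₂ * U₂ * B t₂) * (χ t₃′ * C t₃′))
      ≈⟨ separate-characters (χ -1F) (triv t₁) U₁ (A t₁) (triv t₂) U₂ (B t₂) (χ t₃′) (C t₃′) ⟩
    K t₁ t₂ * (χ -1F * U₁ * U₂ * χ t₃′)
      ≈⟨ *-congˡ (*-congʳ (*-cong (*-cong refl (χ-^ t₁)) (χ-^ t₂))) ⟩
    K t₁ t₂ * (χ -1F * χ (t₁ ^F k) * χ (t₂ ^F k) * χ t₃′)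
      ≈⟨ *-congˡ (sym (trans (χ-· _ t₃′) (*-congʳ (trans (χ-· _ (t₂ ^F k)) (*-congʳ (χ-· -1F (t₁ ^F k))))))) ⟩
    K t₁ t₂ * χ (y t₁ t₂)                                  ∎
    where
    χ = cs i
    χ-· = proj₂ (proj₂ (cs-character i))
    χ-^ : ∀ t → pw R (χ t) k ≈ χ (t ^F k)
    χ-^ t = sym (character-^ (cs-character i) t k)
    U₁ = pw R (χ t₁) k
    U₂ = pw R (χ t₂) k
    t₃′ = t₃ t₁ t₂
    separate-characters : ∀ m T₁ U₁ A₁ T₂ U₂ B₂ V₃ C₃ →
      m * ((T₁ * U₁ * A₁) * (T₂ * U₂ * B₂) * (V₃ * C₃)) ≈ (T₁ * T₂) * ((A₁ * B₂) * C₃) * (m * U₁ * U₂ * V₃)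
    separate-characters = solve 9 (λ m T₁ U₁ A₁ T₂ U₂ B₂ V₃ C₃ →
      m :* ((T₁ :* U₁ :* A₁) :* (T₂ :* U₂ :* B₂) :* (V₃ :* C₃))
        := (T₁ :* T₂) :* ((A₁ :* B₂) :* C₃) :* (m :* U₁ :* U₂ :* V₃)) refl
      where open import Algebra.Solver.Ring.NaturalCoefficients.Default commutativeSemiring

  exchange : ∑ R n (λ i → summand (cs i)) ≈
             ∑ R p (λ t₁ → ∑ R p (λ t₂ → K t₁ t₂ * ∑ R n (λ i → cs i (y t₁ t₂))))
  exchange = begin
    ∑ R n (λ i → summand (cs i))
      ≈⟨ ∑-cong n (λ i → trans (sym (∑-*ˡ p (cs i -1F) (λ t₁ → ∑ R p (λ t₂ → factors i t₁ t₂))))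
                                (∑-cong p (λ t₁ → sym (∑-*ˡ p (cs i -1F) (λ t₂ → factors i t₁ t₂))))) ⟩
    ∑ R n (λ i → ∑ R p (λ t₁ → ∑ R p (λ t₂ → term i t₁ t₂)))
      ≈⟨ ∑-comm n p (λ i t₁ → ∑ R p (λ t₂ → term i t₁ t₂)) ⟩
    ∑ R p (λ t₁ → ∑ R n (λ i → ∑ R p (λ t₂ → term i t₁ t₂)))
      ≈⟨ ∑-cong p (λ t₁ → ∑-comm n p (λ i t₂ → term i t₁ t₂)) ⟩
    ∑ R p (λ t₁ → ∑ R p (λ t₂ → ∑ R n (λ i → term i t₁ t₂)))
      ≈⟨ ∑-cong p (λ t₁ → ∑-cong p (λ t₂ → trans (∑-cong n (λ i → summand-term i t₁ t₂))
                                                    (∑-*ˡ n (K t₁ t₂) (λ i → cs i (y t₁ t₂))))) ⟩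
    ∑ R p (λ t₁ → ∑ R p (λ t₂ → K t₁ t₂ * ∑ R n (λ i → cs i (y t₁ t₂)))) ∎
    where
    term : Fin n → F → F → Carrier
    term i t₁ t₂ = cs i -1F * factors i t₁ t₂

  K-vanishes : ∀ t₁ t₂ → t₁ ≡ 0F ⊎ t₂ ≡ 0F ⊎ t₃ t₁ t₂ ≡ 0F → K t₁ t₂ ≈ 0#
  K-vanishes t₁ t₂ (inj₁ t₁≡0) = trans (*-congʳ (trans (*-congʳ (reflexive (≡.cong triv t₁≡0))) (zeroˡ _))) (zeroˡ _)
  K-vanishes t₁ t₂ (inj₂ (inj₁ t₂≡0)) = trans (*-congʳ (trans (*-congˡ (reflexive (≡.cong triv t₂≡0))) (zeroʳ _))) (zeroˡ _)
  K-vanishes t₁ t₂ (inj₂ (inj₂ t₃≡0)) = trans (*-congˡ (trans (*-congˡ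
    (trans (reflexive (≡.cong C t₃≡0)) (proj₁ (chPow-character ψ-character c′)))) (zeroʳ _))) (zeroʳ _)

  zero-or-torus : ∀ t₁ t₂ → (t₁ ≡ 0F ⊎ t₂ ≡ 0F ⊎ t₃ t₁ t₂ ≡ 0F) ⊎ (t₁ ≢ 0F × t₂ ≢ 0F × t₃ t₁ t₂ ≢ 0F)
  zero-or-torus t₁ t₂ with t₁ FinP.≟ 0F | t₂ FinP.≟ 0F | t₃ t₁ t₂ FinP.≟ 0F
  ... | yes t₁≡0 | _ | _ = inj₁ (inj₁ t₁≡0)
  ... | no _ | yes t₂≡0 | _ = inj₁ (inj₂ (inj₁ t₂≡0))
  ... | no _ | no _ | yes t₃≡0 = inj₁ (inj₂ (inj₂ t₃≡0))
  ... | no t₁≢0 | no t₂≢0 | no t₃≢0 = inj₂ (t₁≢0 , t₂≢0 , t₃≢0)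

  T : F → F → Carrier
  T t₁ t₂ = K t₁ t₂ * ∑ R n (λ i → cs i (y t₁ t₂))

  T-on-lines : ∀ t₁ t₂ → t₁ ≡ 1F ⊎ t₂ ≡ 1F → T t₁ t₂ ≈ K t₁ t₂ * fromℕ R m
  T-on-lines t₁ t₂ on-line with zero-or-torus t₁ t₂
  ... | inj₁ degenerate = trans (*-congʳ (K-vanishes t₁ t₂ degenerate))
                      (trans (zeroˡ _) (sym (trans (*-congʳ (K-vanishes t₁ t₂ degenerate)) (zeroˡ _))))
  ... | inj₂ (t₁≢0 , t₂≢0 , _) = *-congˡ (trans
    (reflexive (≡.cong (λ u → ∑ R n (λ i → cs i u)) (on-a-line⇒y≡1 t₁ t₂ t₁≢0 t₂≢0 on-line)))
    number-of-characters)

  T-off-lines : ∀ t₁ t₂ → t₁ ≢ 1F → t₂ ≢ 1F → T t₁ t₂ ≈ 0#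
  T-off-lines t₁ t₂ t₁≢1 t₂≢1 with zero-or-torus t₁ t₂
  ... | inj₁ degenerate = trans (*-congʳ (K-vanishes t₁ t₂ degenerate)) (zeroˡ _)
  ... | inj₂ (t₁≢0 , t₂≢0 , t₃≢0) = trans (*-congˡ (sum-over-characters-vanishes (y t₁ t₂)
          (y≢0 t₁ t₂ t₁≢0 t₂≢0 t₃≢0) y≢1)) (zeroʳ _)
    where
    y≢1 : y t₁ t₂ ≢ 1F
    y≢1 y≡1 = [ t₁≢1 , t₂≢1 ]′ (y≡1⇒on-a-line t₁ t₂ t₁≢0 t₂≢0 y≡1)

  K-on-line₁ : ∀ t → K 1F t ≈ B t * C t
  K-on-line₁ t = begin
    (triv 1F * triv t) * ((A 1F * B t) * C (t₃ 1F t))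
      ≈⟨ *-cong (*-identityˡ _) (*-cong (trans (*-congʳ A1≈1) (*-identityˡ _))
                                        (trans (reflexive (≡.cong C (t₃-1ˡ t))) (chPow-even c′ t))) ⟩
    triv t * (B t * C t)          ≈⟨ sym (*-assoc _ _ _) ⟩
    (triv t * B t) * C t          ≈⟨ *-congʳ (triv-absorbs (chPow-character ψ-character b) t) ⟩
    B t * C t                     ∎
    where A1≈1 = proj₁ (proj₂ (chPow-character ψ-character a))

  K-on-line₂ : ∀ t → K t 1F ≈ A t * C t
  K-on-line₂ t = begin
    (triv t * triv 1F) * ((A t * B 1F) * C (t₃ t 1F))
      ≈⟨ *-cong (*-identityʳ _) (*-cong (trans (*-congˡ B1≈1) (*-identityʳ _))
                                        (trans (reflexive (≡.cong C (t₃-1ʳ t))) (chPow-even c′ t))) ⟩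
    triv t * (A t * C t)          ≈⟨ sym (*-assoc _ _ _) ⟩
    (triv t * A t) * C t          ≈⟨ *-congʳ (triv-absorbs (chPow-character ψ-character a) t) ⟩
    A t * C t                     ∎
    where B1≈1 = proj₁ (proj₂ (chPow-character ψ-character b))

  K-at-1,1 : K 1F 1F ≈ 1#
  K-at-1,1 = trans (K-on-line₁ 1F) (trans (*-cong (proj₁ (proj₂ (chPow-character ψ-character b)))
    (proj₁ (proj₂ (chPow-character ψ-character c′)))) (*-identityˡ 1#))

  character-sum : ∑ R n (λ i → summand (cs i)) ≈ - fromℕ R m
  character-sum = begin
    ∑ R n (λ i → summand (cs i))                              ≈⟨ exchange ⟩
    ∑ R p (λ t₁ → ∑ R p (T t₁))                               ≈⟨ ∑-cross p p 1F 1F T T-off-lines ⟩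
    ∑ R p (λ t → T t 1F) + (∑ R p (T 1F) - T 1F 1F)
      ≈⟨ +-cong (∑-cong p (λ t → T-on-lines t 1F (inj₂ ≡.refl)))
                (+-cong (∑-cong p (λ t → T-on-lines 1F t (inj₁ ≡.refl))) (-‿cong (T-on-lines 1F 1F (inj₁ ≡.refl)))) ⟩
    ∑ R p (λ t → K t 1F * M) + (∑ R p (λ t → K 1F t * M) - K 1F 1F * M)
      ≈⟨ +-cong (trans (∑-*ʳ p M (λ t → K t 1F)) (*-congʳ line₂))
                (+-cong (trans (∑-*ʳ p M (K 1F)) (*-congʳ line₁)) (-‿cong (*-congʳ K-at-1,1))) ⟩
    0# * M + (0# * M - 1# * M)                                ≈⟨ +-cong (zeroˡ M) (+-cong (zeroˡ M) (-‿cong (*-identityˡ M))) ⟩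
    0# + (0# - M)                                             ≈⟨ trans (+-identityˡ _) (+-identityˡ _) ⟩
    - M                                                       ∎
    where
    M = fromℕ R m
    line₁ : ∑ R p (K 1F) ≈ 0#
    line₁ = trans (∑-cong p K-on-line₁) (sum-of-product-vanishes b c′ 5∤b+c)
    line₂ : ∑ R p (λ t → K t 1F) ≈ 0#
    line₂ = trans (∑-cong p K-on-line₂) (sum-of-product-vanishes a c′ 5∤a+c)

open import Data.Nat using (ℕ; NonZero; _%_; _∸_)
open import Data.Nat.Primality using (Prime)
open import Data.Fin using (Fin)
open import Data.Product using (Σ)
open import Data.Integer using (ℤ; +_) renaming (_+_ to _+ℤ_)
open import Data.Integer.Divisibility using (_∣_)
open import Relation.Nullary using (¬_)
open import Relation.Binary.PropositionalEquality using (_≡_)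
open import Algebra.Bundles using (CommutativeRing)

lemma2p2 : ∀ {c ℓ} (R : CommutativeRing c ℓ) → IsIntegralDomain R → HasCharZero R
    → (p : ℕ) {{_ : NonZero p}} → Prime p → p % 5 ≡ 1
    → Σ (CommutativeRing.Carrier R) (IsPrimitiveRoot R (p ∸ 1))
    → (ψ : Fp.Fn R p) → Fp.IsCharacter R p ψ → Fp.HasOrder R p ψ 5
    → (a b c' : ℤ) → ¬ ((+ 5) ∣ (a +ℤ c')) → ¬ ((+ 5) ∣ (b +ℤ c'))
    → (n : ℕ) (cs : Fin n → Fp.Fn R p) → Fp.EnumeratesCharacters R p n cs
    → CommutativeRing._≈_ R
        (∑ R n (λ i → CommutativeRing._*_ R (cs i (Fp.-1F R p))
            (Fp.J₃ R p (Fp._⊗_ R p (Fp.conj R p (cs i)) (Fp.chPow R p ψ a))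
                       (Fp._⊗_ R p (Fp.conj R p (cs i)) (Fp.chPow R p ψ b))
                       (Fp._⊗_ R p (cs i) (Fp.chPow R p ψ c')))))
        (CommutativeRing.-_ R (fromℕ R (p ∸ 1)))
lemma2p2 R _ _ zero p-prime = ⊥-elim (ℕP.n≮0 (NatFacts.prime>1 p-prime))
lemma2p2 R _ _ (suc zero) p-prime = ⊥-elim (ℕP.<-irrefl ≡.refl (NatFacts.prime>1 p-prime))
lemma2p2 R domain _ p@(suc (suc k)) p-prime p≡1 (ζ , ζ-primitive) ψ ψ-character ψ-order
         a b c′ 5∤a+c 5∤b+c n cs enumerates =
  CharacterSumOfJacobiSums.character-sum R domain k p-prime ζ ζ-primitive
    (NatFacts.≡1-mod-5⇒5∣pred p p≡1) ψ ψ-character ψ-order a b c′ 5∤a+c 5∤b+c n cs enumerates
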